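{- Let $S$ be a signature, $F_1,F_2$ leaning $S$-forests, and $k$ the size of $F_1$. For any leaning $S$-forest $F$: (i) $F_1\rhd F_2\preceq F$ if and only if $F_1\preceq\Uparrow_k F$ and $F_2\preceq\Downarrow_k F$; (ii) $F\preceq F_1\lhd F_2$ if and only if $\Uparrow_k F\preceq F_1$ and $\Downarrow_k F\preceq F_2$.
   Context: A signature is a set $S$ with arity map $|\cdot|:S\to\mathbb N$. An $S$-term is the leaf $\ell$ or $s\,t_1\cdots t_{|s|}$ with $s\in S$ and $S$-terms $t_i$. Internal nodes are numbered in preorder (root, then subterms left to right); $\mathrm{dc}(t)$ is the decoration word; the parent edge of node $i$ is $(\mathrm{pa}(i),\mathrm{lp}(i),i)$ with $i$ the $\mathrm{lp}(i)$-th child (leaves counted) of $\mathrm{pa}(i)$, and $\mathrm{pa}(1)=1,\mathrm{lp}(1)=0$; $\mathrm{cnc}(t)(i)=\mathrm{pa}(i)+1-2^{\mathrm{lp}(i)-a}$ with $a$ the arity of the decoration of $\mathrm{pa}(i)$; $t_1\preceq t_2$ iff $\mathrm{dc}(t_1)=\mathrm{dc}(t_2)$ and $\mathrm{cnc}(t_1)\le\mathrm{cnc}(t_2)$ componentwise. A leaf is extreme if all internal nodes precede it in preorder. $\mathrm{tlt}(\{1\})$ reorders the root's children so non-leaf children keep their order and precede leaf children. $S_{\mathbb N}=S\sqcup\mathbb N$, $n\in\mathbb N$ of arity $n$. An $S$-forest is an $S_{\mathbb N}$-term $n\,t_1\cdots t_n$ with $t_i$ $S$-terms; balanced if of degree $n+1$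 (size $n$); leaning if balanced and fixed by $\mathrm{tlt}(\{1\})$. Concatenation $(n\,t_1\cdots t_n)\cdot(n'\,t'_1\cdots t'_{n'})=(n+n')\,t_1\cdots t_nt'_1\cdots t'_{n'}$; $c(k)=k\,\ell\cdots\ell$. Over: $F_1\rhd F_2=\mathrm{tlt}(\{1\})(F_1\cdot F_2)$. Under: if $F_2$ has size $n_2$ and $F_1$ has $r$ extreme leaves, $F_1\lhd F_2$ is obtained by grafting, for $j\in[n_2+r]$, the $j$-th child subterm of the root of $F_2\cdot c(r)$ onto the $j$-th extreme leaf of $F_1\cdot c(n_2)$. Restriction: for a leaning forest $F$ of size $n$ and $I\subseteq[n]$, $F|_I$ is obtained by keeping only the internal nodes in $\{1\}\cup\{i+1:i\in I\}$: kept non-root nodes with kept parent keep their parent edge, deleted non-root nodes' positions become leaves, kept non-root nodes all of whose proper ancestors other than $1$ are deleted become, in preorder order, the first children of the root, and the root is decorated by $|I|$ and completed by leaves to $|I|$ children. $\Uparrow_k F=F|_{[1,k]}$ and $\Downarrow_k F=F|_{[k+1,n]}$. -}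

module Defs where

open import Data.Nat as ℕ using (ℕ; zero; suc; _+_; _∸_; _^_; _≤ᵇ_)
open import Data.Nat.Properties using (m^n≢0)
open import Data.Bool using (Bool; true; false; if_then_else_; not)
open import Data.List as L using (List; []; _∷_; _++_; length; map; replicate; reverse; concat)
open import Data.Vec as V using (Vec; []; _∷_)
open import Data.Maybe using (Maybe; just; nothing)
open import Data.Sum using (_⊎_; inj₁; inj₂; [_,_])
open import Data.Product using (_×_; _,_; proj₁; proj₂)
open import Data.Integer using (+_)
open import Data.Rational as ℚ using (ℚ)
open import Data.List.Relation.Binary.Pointwise using (Pointwise)
open import Relation.Binary.PropositionalEquality using (_≡_)

record Signature : Set₁ where
  field
    Sym : Set
    ar  : Sym → ℕ
open Signature public

data Term (Σ : Signature) : Set where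
  leaf : Term Σ
  node : (s : Sym Σ) → Vec (Term Σ) (ar Σ s) → Term Σ

-- Information attached to an internal node (in preorder):
-- its decoration, pa(i), lp(i), and the arity of the decoration of pa(i).
record NodeInfo (Σ : Signature) : Set where
  constructor info
  field
    dec  : Sym Σ
    pa   : ℕ
    lp   : ℕ
    paAr : ℕ
open NodeInfo public

module _ {Σ : Signature} where

  mutual
    degree : Term Σ → ℕ
    degree leaf = 0
    degree (node s ts) = suc (degreeV ts)

    degreeV : ∀ {m} → Vec (Term Σ) m → ℕ
    degreeV [] = 0
    degreeV (t ∷ ts) = degree t + degreeV ts

  mutual
    -- preorder list of internal nodes of a subterm whose root gets number
    -- 'self', with parent 'p', position 'l' in the parent, parent arity 'a'
    nodesT : Term Σ → (self p l a : ℕ) → List (NodeInfo Σ)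
    nodesT leaf self p l a = []
    nodesT (node s ts) self p l a = info s p l a ∷ nodesV ts self (ar Σ s) 1 (suc self)

    -- children of node number 'par' (of arity 'a'), starting at position
    -- 'pos' (leaves counted), next free preorder number 'next'
    nodesV : ∀ {m} → Vec (Term Σ) m → (par a pos next : ℕ) → List (NodeInfo Σ)
    nodesV [] par a pos next = []
    nodesV (t ∷ ts) par a pos next =
      nodesT t next par pos a ++ nodesV ts par a (suc pos) (next + degree t)

  -- internal nodes numbered 1,2,… in preorder; pa(1) = 1, lp(1) = 0
  nodes : Term Σ → List (NodeInfo Σ)
  nodes leaf = []
  nodes (node s ts) = nodesT (node s ts) 1 1 0 (ar Σ s)

  dc : Term Σ → List (Sym Σ)
  dc t = map dec (nodes t)

  -- pa(i) + 1 - 2^(lp(i) - a); note lp(i) ≤ a always, so 2^(lp(i)-a) = 1 / 2^(a - lp(i))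
  cncVal : NodeInfo Σ → ℚ
  cncVal (info _ p l a) =
    ((+ (suc p)) ℚ./ 1) ℚ.- _ℚ/_ (+ 1) (2 ^ (a ∸ l)) {{m^n≢0 2 (a ∸ l)}}
    where
    _ℚ/_ = ℚ._/_

  cnc : Term Σ → List ℚ
  cnc t = map cncVal (nodes t)

  _≼_ : Term Σ → Term Σ → Set
  t₁ ≼ t₂ = (dc t₁ ≡ dc t₂) × Pointwise ℚ._≤_ (cnc t₁) (cnc t₂)

  -- preorder word with leaves as 'nothing' (Polish notation)
  mutual
    pw : Term Σ → List (Maybe (Sym Σ))
    pw leaf = nothing ∷ []
    pw (node s ts) = just s ∷ pwV ts

    pwV : ∀ {m} → Vec (Term Σ) m → List (Maybe (Sym Σ))
    pwV [] = []
    pwV (t ∷ ts) = pw t ++ pwV ts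

  isLeaf : Term Σ → Bool
  isLeaf leaf = true
  isLeaf (node _ _) = false

  -- substitute the j-th leaf (0-based, preorder) by f j; returns next leaf index
  mutual
    substT : (ℕ → Term Σ) → Term Σ → ℕ → Term Σ × ℕ
    substT f leaf j = f j , suc j
    substT f (node s ts) j = node s (proj₁ (substV f ts j)) , proj₂ (substV f ts j)

    substV : ∀ {m} → (ℕ → Term Σ) → Vec (Term Σ) m → ℕ → Vec (Term Σ) m × ℕ
    substV f [] j = [] , j
    substV f (t ∷ ts) j =
      proj₁ (substT f t j) ∷ proj₁ (substV f ts (proj₂ (substT f t j))) ,
      proj₂ (substV f ts (proj₂ (substT f t j)))

  substL : (ℕ → Term Σ) → List (Term Σ) → ℕ → List (Term Σ) × ℕ
  substL f [] j = [] , j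
  substL f (t ∷ ts) j =
    proj₁ (substT f t j) ∷ proj₁ (substL f ts (proj₂ (substT f t j))) ,
    proj₂ (substL f ts (proj₂ (substT f t j)))

leadingNothings : {A : Set} → List (Maybe A) → ℕ
leadingNothings [] = 0
leadingNothings (nothing ∷ xs) = suc (leadingNothings xs)
leadingNothings (just _ ∷ xs) = 0

countNothings : {A : Set} → List (Maybe A) → ℕ
countNothings [] = 0
countNothings (nothing ∷ xs) = suc (countNothings xs)
countNothings (just _ ∷ xs) = countNothings xs

-- Number of extreme leaves of t: the leaves after which no internal node
-- occurs in preorder, i.e. the final block of leaves of the preorder word.
extremeCount : {Σ : Signature} → Term Σ → ℕ
extremeCount t = leadingNothings (reverse (pw t))

leafCount : {Σ : Signature} → Term Σ → ℕ
leafCount t = countNothings (pw t)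

SN : Signature → Signature
SN Σ = record { Sym = Sym Σ ⊎ ℕ ; ar = [ ar Σ , (λ n → n) ] }

mutual
  embed : {Σ : Signature} → Term Σ → Term (SN Σ)
  embed leaf = leaf
  embed (node s ts) = node (inj₁ s) (embedV ts)

  embedV : {Σ : Signature} {m : ℕ} → Vec (Term Σ) m → Vec (Term (SN Σ)) m
  embedV [] = []
  embedV (t ∷ ts) = embed t ∷ embedV ts

-- An S-forest n t₁ ⋯ tₙ is represented by the list t₁ ⋯ tₙ
Forest : Signature → Set
Forest Σ = List (Term Σ)

module _ {Σ : Signature} where

  toTerm : Forest Σ → Term (SN Σ)
  toTerm ts = node (inj₂ (length ts)) (embedV (V.fromList ts))

  size : Forest Σ → ℕ
  size = length

  Balanced : Forest Σ → Set
  Balanced F = degree (toTerm F) ≡ suc (size F)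

  -- tlt({1}): non-leaf children of the root keep their order and precede leaf children
  nonLeaves : Forest Σ → Forest Σ
  nonLeaves [] = []
  nonLeaves (leaf ∷ ts) = nonLeaves ts
  nonLeaves (node s us ∷ ts) = node s us ∷ nonLeaves ts

  leaves : Forest Σ → Forest Σ
  leaves [] = []
  leaves (leaf ∷ ts) = leaf ∷ leaves ts
  leaves (node s us ∷ ts) = leaves ts

  tlt1 : Forest Σ → Forest Σ
  tlt1 F = nonLeaves F ++ leaves F

  Leaning : Forest Σ → Set
  Leaning F = Balanced F × (tlt1 F ≡ F)

  _≼F_ : Forest Σ → Forest Σ → Set
  F₁ ≼F F₂ = toTerm F₁ ≼ toTerm F₂

  _·_ : Forest Σ → Forest Σ → Forest Σ
  F₁ · F₂ = F₁ ++ F₂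

  c : ℕ → Forest Σ
  c k = replicate k leaf

  _▷_ : Forest Σ → Forest Σ → Forest Σ
  F₁ ▷ F₂ = tlt1 (F₁ · F₂)

  nth : Forest Σ → ℕ → Term Σ
  nth [] _ = leaf
  nth (t ∷ ts) zero = t
  nth (t ∷ ts) (suc j) = nth ts j

  -- under: graft the j-th child of the root of F₂·c(r) onto the j-th
  -- extreme leaf of F₁·c(n₂).  Leaves are numbered 0,1,… in preorder;
  -- the extreme ones are those numbered ≥ off = #leaves - #extreme leaves.
  _◁_ : Forest Σ → Forest Σ → Forest Σ
  F₁ ◁ F₂ = proj₁ (substL f T 0)
    where
    r   = extremeCount (toTerm F₁)
    T   = F₁ · c (size F₂)
    G   = F₂ · c r
    off = leafCount (toTerm T) ∸ extremeCount (toTerm T)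
    f : ℕ → Term Σ
    f j = if off ≤ᵇ j then nth G (j ∸ off) else leaf

  -- restriction.  Non-root internal nodes of a forest are numbered 1,…,n in
  -- preorder (node number i here is node i+1 of the S_ℕ-term); I is given by
  -- its characteristic function 'keep'.
  asRootChild : Term Σ → List (Term Σ)
  asRootChild leaf = []
  asRootChild (node s ts) = node s ts ∷ []

  mutual
    -- returns: the term at this position, the detached subterms (in preorder),
    -- and the next free node number
    restrT : (ℕ → Bool) → Term Σ → ℕ → Term Σ × List (Term Σ) × ℕ
    restrT keep leaf i = leaf , [] , i
    restrT keep (node s ts) i = restrNode keep s (keep i) (restrV keep ts (suc i))

    restrNode : (ℕ → Bool) → (s : Sym Σ) → Bool →
                Vec (Term Σ × List (Term Σ)) (ar Σ s) × ℕ →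
                Term Σ × List (Term Σ) × ℕ
    restrNode keep s true (ps , i) =
      node s (V.map proj₁ ps) , concat (V.toList (V.map proj₂ ps)) , i
    restrNode keep s false (ps , i) =
      leaf , concat (V.toList (V.map (λ p → asRootChild (proj₁ p) ++ proj₂ p) ps)) , i

    restrV : ∀ {m} → (ℕ → Bool) → Vec (Term Σ) m → ℕ →
             Vec (Term Σ × List (Term Σ)) m × ℕ
    restrV keep [] i = [] , i
    restrV keep (t ∷ ts) i =
      (proj₁ (restrT keep t i) , proj₁ (proj₂ (restrT keep t i)))
        ∷ proj₁ (restrV keep ts (proj₂ (proj₂ (restrT keep t i)))) ,
      proj₂ (restrV keep ts (proj₂ (proj₂ (restrT keep t i))))

  restrL : (ℕ → Bool) → Forest Σ → ℕ → List (Term Σ)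
  restrL keep [] i = []
  restrL keep (t ∷ ts) i =
    asRootChild (proj₁ (restrT keep t i)) ++ proj₁ (proj₂ (restrT keep t i))
      ++ restrL keep ts (proj₂ (proj₂ (restrT keep t i)))

  countKeep : (ℕ → Bool) → ℕ → ℕ
  countKeep keep zero = 0
  countKeep keep (suc n) = countKeep keep n + (if keep (suc n) then 1 else 0)

  restrict : Forest Σ → (ℕ → Bool) → Forest Σ
  restrict F keep = R ++ c (countKeep keep (size F) ∸ length R)
    where
    R = restrL keep F 1

  ⇑ : ℕ → Forest Σ → Forest Σ
  ⇑ k F = restrict F (λ i → i ≤ᵇ k)

  ⇓ : ℕ → Forest Σ → Forest Σ
  ⇓ k F = restrict F (λ i → not (i ≤ᵇ k))

-- Writing cnc(i) = pa(i) + 1 - 2^(lp(i) - a), cnc values compare lexicographically by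
-- (pa(i), a - lp(i)); so F ≼ G says that F and G have the same size and decorations and that,
-- node by node below the root, this pair is lexicographically smaller in F. In a leaning forest the
-- root children come in order, at positions 1, 2, …, so comparisons involving root children are
-- automatic and only the deeper nodes matter.
--
-- The nodes of F₁ ▷ F₂ are those of F₁ followed by those of F₂ with parent numbers shifted by
-- k = size F₁, just as the nodes of F split into those of ⇑_k F (a truncation of F) and those of
-- ⇓_k F (the pieces below, shifted back by k).
--
-- For (ii) the nodes are computed by a stack machine on the Polish word. In F₁ ◁ F₂ the first k nodes
-- are those of F₁; the slots then pending are the extreme leaves of F₁, and the trees of F₂ fill them.
-- If the first k nodes of F are dominated by those of F₁, every slot they fill is dominated, so the
-- slots pending after them form a sublist of those of F₁; this is what allows comparing the remaining
-- nodes of F with the grafted nodes of F₂.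
module Submission where

open import Defs
open import Data.Bool using (Bool; true; false; T; if_then_else_; not)
open import Data.Bool.Properties using (T-≡)
open import Data.Empty using (⊥; ⊥-elim)
import Data.Integer as ℤ
import Data.Integer.Properties as ℤP
open import Data.List
  using (List; []; _∷_; _++_; length; map; replicate; reverse; concat; take; drop)
import Data.List.Properties as LP
open import Data.List.Relation.Binary.Pointwise as PW using (Pointwise; []; _∷_)
open import Data.List.Relation.Unary.All as All using (All; []; _∷_)
import Data.List.Relation.Unary.All.Properties as AllP
open import Data.List.Relation.Unary.AllPairs as AllPairs using (AllPairs; []; _∷_)
import Data.List.Relation.Unary.AllPairs.Properties as AllPairsP
open import Data.List.Relation.Binary.Sublist.Propositional using (_⊆_; []; _∷_; _∷ʳ_; minimum; ⊆-refl; ⊆-trans)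
import Data.List.Relation.Binary.Sublist.Propositional.Properties as SubP
open import Data.Maybe as M using (Maybe; just; nothing)
open import Data.Nat as ℕ
  using (ℕ; zero; suc; _+_; _*_; _∸_; _^_; _≤_; _<_; z≤n; s≤s; _≤ᵇ_; _⊓_)
import Data.Nat.Properties as NP
open import Algebra.Properties.CommutativeSemigroup NP.+-commutativeSemigroup using (xy∙z≈xz∙y)
open import Data.Nat.Tactic.RingSolver using (solve-∀)
open import Data.Product as Product using (_×_; _,_; proj₁; proj₂; ∃₂)
open import Data.Rational as ℚ using (ℚ; toℚᵘ)
import Data.Rational.Properties as ℚP
open import Data.Rational.Unnormalised as ℚᵘ using (mkℚᵘ; *≤*; *≡*)
import Data.Rational.Unnormalised.Properties as ℚᵘP
open import Data.Sum as Sum using (_⊎_; inj₁; inj₂; [_,_])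
import Data.Sum.Properties as SumP
open import Data.Vec as V using (Vec; []; _∷_)
open import Function.Bundles using (_⇔_; mk⇔; Equivalence)
open import Function.Properties.Equivalence using () renaming (trans to ⇔-trans; sym to ⇔-sym)
open import Data.Product.Function.NonDependent.Propositional using (_×-⇔_)
open import Relation.Binary using (tri<; tri≈; tri>)
open import Relation.Binary.PropositionalEquality hiding ([_])
open import Relation.Binary.PropositionalEquality.Core using (_≢_)
open import Relation.Nullary using (yes; no)

2≤⇒≢1 : ∀ {n} → 2 ≤ n → n ≢ 1
2≤⇒≢1 (s≤s ()) refl

2≤⇒≮[1] : ∀ {n m} → 2 ≤ n → n < m → m ≡ 1 → ⊥
2≤⇒≮[1] (s≤s (s≤s _)) (s≤s (s≤s _)) ()

module _ {A : Set} where

  take-++ : ∀ m (xs ys : List A) → take m (xs ++ ys) ≡ take m xs ++ take (m ∸ length xs) ys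
  take-++ zero [] ys = refl
  take-++ zero (x ∷ xs) ys = refl
  take-++ (suc m) [] ys = refl
  take-++ (suc m) (x ∷ xs) ys = cong (x ∷_) (take-++ m xs ys)

  drop-++ : ∀ m (xs ys : List A) → drop m (xs ++ ys) ≡ drop m xs ++ drop (m ∸ length xs) ys
  drop-++ zero [] ys = refl
  drop-++ zero (x ∷ xs) ys = refl
  drop-++ (suc m) [] ys = refl
  drop-++ (suc m) (x ∷ xs) ys = drop-++ m xs ys

  take-length-++ : ∀ (xs ys : List A) → take (length xs) (xs ++ ys) ≡ xs
  take-length-++ [] ys = refl
  take-length-++ (x ∷ xs) ys = cong (x ∷_) (take-length-++ xs ys)

  drop-length-++ : ∀ (xs ys : List A) → drop (length xs) (xs ++ ys) ≡ ys
  drop-length-++ [] ys = refl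
  drop-length-++ (x ∷ xs) ys = drop-length-++ xs ys

module _ {A B : Set} {R : A → B → Set} where

  Pointwise-++ˡ⁻ : ∀ (xs ys : List A) (zs : List B) → Pointwise R (xs ++ ys) zs →
                   Pointwise R xs (take (length xs) zs) × Pointwise R ys (drop (length xs) zs)
  Pointwise-++ˡ⁻ [] ys zs p = [] , p
  Pointwise-++ˡ⁻ (x ∷ xs) ys (z ∷ zs) (r ∷ p) = Product.map₁ (r ∷_) (Pointwise-++ˡ⁻ xs ys zs p)

  Pointwise-++ʳ⁻ : ∀ (zs : List A) (xs ys : List B) → Pointwise R zs (xs ++ ys) →
                   Pointwise R (take (length xs) zs) xs × Pointwise R (drop (length xs) zs) ys
  Pointwise-++ʳ⁻ zs [] ys p = [] , p
  Pointwise-++ʳ⁻ (z ∷ zs) (x ∷ xs) ys (r ∷ p) = Product.map₁ (r ∷_) (Pointwise-++ʳ⁻ zs xs ys p)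

  Pointwise-++ˡ⁺ : ∀ {xs ys : List A} (zs : List B) m →
                   Pointwise R xs (take m zs) → Pointwise R ys (drop m zs) → Pointwise R (xs ++ ys) zs
  Pointwise-++ˡ⁺ zs m p q = subst (Pointwise R _) (LP.take++drop≡id m zs) (PW.++⁺ p q)

  Pointwise-++ʳ⁺ : ∀ (zs : List A) {xs ys : List B} m →
                   Pointwise R (take m zs) xs → Pointwise R (drop m zs) ys → Pointwise R zs (xs ++ ys)
  Pointwise-++ʳ⁺ zs m p q = subst (λ w → Pointwise R w _) (LP.take++drop≡id m zs) (PW.++⁺ p q)

module _ {A A' B B' : Set} {R : A → A' → Set} {S : B → B' → Set} where

  Pointwise-push : ∀ {W : A → B → Set} {W' : A' → B' → Set} →
                   (∀ {x x' y y'} → R x x' → S y y' → W x y → W' x' y') →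
                   ∀ {xs xs' ys ys'} → Pointwise R xs xs' → Pointwise S ys ys' → Pointwise W xs ys → Pointwise W' xs' ys'
  Pointwise-push f [] [] [] = []
  Pointwise-push f (r ∷ rs) (s ∷ ss) (w ∷ ws) = f r s w ∷ Pointwise-push f rs ss ws

  Pointwise-pull : ∀ {W : A' → B' → Set} {W' : A → B → Set} →
                   (∀ {x x' y y'} → R x x' → S y y' → W x' y' → W' x y) →
                   ∀ {xs xs' ys ys'} → Pointwise R xs xs' → Pointwise S ys ys' → Pointwise W xs' ys' → Pointwise W' xs ys
  Pointwise-pull f [] [] [] = []
  Pointwise-pull f (r ∷ rs) (s ∷ ss) (w ∷ ws) = f r s w ∷ Pointwise-pull f rs ss ws

≤ᵇ≡true⇒≤ : ∀ {i k} → (i ≤ᵇ k) ≡ true → i ≤ k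
≤ᵇ≡true⇒≤ {i} {k} eq = NP.≤ᵇ⇒≤ i k (subst T (sym eq) _)

≤ᵇ-true : ∀ {i k} → i ≤ k → (i ≤ᵇ k) ≡ true
≤ᵇ-true h = T-≡ .Equivalence.to (NP.≤⇒≤ᵇ h)

≤ᵇ-false : ∀ {i k} → k < i → (i ≤ᵇ k) ≡ false
≤ᵇ-false {i} {k} h with i ≤ᵇ k in eq
... | false = refl
... | true = ⊥-elim (NP.<⇒≱ h (≤ᵇ≡true⇒≤ {i} {k} eq))

≤ᵇ≡false⇒> : ∀ {i k} → (i ≤ᵇ k) ≡ false → k < i
≤ᵇ≡false⇒> eq = NP.≰⇒> (λ le → true≢false (trans (sym (≤ᵇ-true le)) eq))
  where
  true≢false : true ≢ false
  true≢false ()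

m∸n+[o∸[n∸m]]≡m+o∸n : ∀ m n o → (m ∸ n) + (o ∸ (n ∸ m)) ≡ (m + o) ∸ n
m∸n+[o∸[n∸m]]≡m+o∸n zero zero o = refl
m∸n+[o∸[n∸m]]≡m+o∸n zero (suc n) o = refl
m∸n+[o∸[n∸m]]≡m+o∸n (suc m) zero o = refl
m∸n+[o∸[n∸m]]≡m+o∸n (suc m) (suc n) o = m∸n+[o∸[n∸m]]≡m+o∸n m n o

drop≡singleton⇒length : ∀ {A : Set} m (xs : List A) {z} → drop m xs ≡ z ∷ [] → length xs ≡ m + 1
drop≡singleton⇒length zero (x ∷ []) refl = refl
drop≡singleton⇒length (suc m) (x ∷ xs) e = cong suc (drop≡singleton⇒length m xs e)

cncValue : ℕ → ℕ → ℚ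
cncValue p e = ((ℤ.+ suc p) ℚ./ 1) ℚ.- ℚ._/_ (ℤ.+ 1) (2 ^ e) {{NP.m^n≢0 2 e}}

toℚᵘ-/ : ∀ i n .{{_ : ℕ.NonZero n}} → toℚᵘ (i ℚ./ n) ℚᵘ.≃ mkℚᵘ i (ℕ.pred n)
toℚᵘ-/ i (suc d) = ℚP.toℚᵘ-fromℚᵘ (mkℚᵘ i d)

toℚᵘ-homo-sub : ∀ a b → toℚᵘ (a ℚ.- b) ℚᵘ.≃ toℚᵘ a ℚᵘ.- toℚᵘ b
toℚᵘ-homo-sub a b =
  ℚᵘP.≃-trans (ℚP.toℚᵘ-homo-+ a (ℚ.- b)) (ℚᵘP.+-congʳ (toℚᵘ a) (ℚP.toℚᵘ-homo‿- b))

suc-minus-unit-fraction : ∀ p d →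
  mkℚᵘ (ℤ.+ suc p) 0 ℚᵘ.- mkℚᵘ (ℤ.+ 1) d ℚᵘ.≃ mkℚᵘ (ℤ.+ (d + p * suc d)) d
suc-minus-unit-fraction p d =
  *≡* (cong (λ x → ℤ.+ (d + p * suc d) ℤ.* ℤ.+ suc x) (sym (NP.+-identityʳ d)))

toℚᵘ-cncValue : ∀ p e → let d = ℕ.pred (2 ^ e) in
  toℚᵘ (cncValue p e) ℚᵘ.≃ mkℚᵘ (ℤ.+ (d + p * suc d)) d
toℚᵘ-cncValue p e = ℚᵘP.≃-trans (toℚᵘ-homo-sub ((ℤ.+ suc p) ℚ./ 1) unit)
  (ℚᵘP.≃-trans (ℚᵘP.+-cong (toℚᵘ-/ (ℤ.+ suc p) 1) (ℚᵘP.-‿cong (toℚᵘ-/ (ℤ.+ 1) (2 ^ e) {{NP.m^n≢0 2 e}})))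
               (suc-minus-unit-fraction p (ℕ.pred (2 ^ e))))
  where unit = ℚ._/_ (ℤ.+ 1) (2 ^ e) {{NP.m^n≢0 2 e}}

mkℚᵘ-≤⇔ : ∀ a d b d' → (mkℚᵘ (ℤ.+ a) d ℚᵘ.≤ mkℚᵘ (ℤ.+ b) d') ⇔ (a * suc d' ≤ b * suc d)
mkℚᵘ-≤⇔ a d b d' = mk⇔
  (λ { (*≤* le) → ℤP.drop‿+≤+ (subst₂ ℤ._≤_ (sym (ℤP.pos-* a (suc d'))) (sym (ℤP.pos-* b (suc d))) le) })
  (λ le → *≤* (subst₂ ℤ._≤_ (ℤP.pos-* a (suc d')) (ℤP.pos-* b (suc d)) (ℤ.+≤+ le)))

_<ₗₑₓ_ : ℕ × ℕ → ℕ × ℕ → Set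
(p , e) <ₗₑₓ (q , f) = p < q ⊎ (p ≡ q × e ≤ f)

-- Writing M = (d + 1)(d' + 1), the cross products are (p + 1) M - (d' + 1) and (q + 1) M - (d + 1),
-- and the corrections d' + 1, d + 1 never exceed M.
cross-≤⇔lex : ∀ p d q d' →
  ((d + p * suc d) * suc d' ≤ (d' + q * suc d') * suc d) ⇔ ((p , d) <ₗₑₓ (q , d'))
cross-≤⇔lex p d q d' = mk⇔ to from
  where
  M = suc d * suc d'
  X = (d + p * suc d) * suc d'
  Y = (d' + q * suc d') * suc d
  X+ : X + suc d' + suc d ≡ suc p * M + suc d
  X+ = identity d d' p
    where
    identity : ∀ d d' p → (d + p * suc d) * suc d' + suc d' + suc d ≡ suc p * (suc d * suc d') + suc d
    identity = solve-∀
  Y+ : Y + suc d' + suc d ≡ suc q * M + suc d'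
  Y+ = identity d d' q
    where
    identity : ∀ d d' q → (d' + q * suc d') * suc d + suc d' + suc d ≡ suc q * (suc d * suc d') + suc d'
    identity = solve-∀
  X≤Y⇔ : X ≤ Y ⇔ (suc p * M + suc d ≤ suc q * M + suc d')
  X≤Y⇔ = mk⇔
    (λ le → subst₂ _≤_ X+ Y+ (NP.+-monoˡ-≤ (suc d) (NP.+-monoˡ-≤ (suc d') le)))
    (λ le → NP.+-cancelʳ-≤ (suc d') X Y (NP.+-cancelʳ-≤ (suc d) _ _ (subst₂ _≤_ (sym X+) (sym Y+) le)))
  dominates : ∀ a b → a < b → ∀ u v → u ≤ M → a * M + u < b * M + suc v
  dominates a b a<b u v u≤M = begin-strict
    a * M + u    ≤⟨ NP.+-monoʳ-≤ (a * M) u≤M ⟩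
    a * M + M    ≡⟨ NP.+-comm (a * M) M ⟩
    suc a * M    ≤⟨ NP.*-monoˡ-≤ M a<b ⟩
    b * M        <⟨ NP.m<m+n (b * M) (s≤s z≤n) ⟩
    b * M + suc v ∎
    where open NP.≤-Reasoning
  to : X ≤ Y → (p , d) <ₗₑₓ (q , d')
  to le with NP.<-cmp p q | X≤Y⇔ .Equivalence.to le
  ... | tri< p<q _ _ | _   = inj₁ p<q
  ... | tri≈ _ refl _ | le' = inj₂ (refl , NP.≤-pred (NP.+-cancelˡ-≤ (suc p * M) (suc d) (suc d') le'))
  ... | tri> _ _ q<p | le' =
    ⊥-elim (NP.<⇒≱ (dominates (suc q) (suc p) (s≤s q<p) (suc d') d (NP.m≤n*m (suc d') (suc d))) le')
  from : (p , d) <ₗₑₓ (q , d') → X ≤ Y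
  from (inj₁ p<q) = X≤Y⇔ .Equivalence.from
    (NP.<⇒≤ (dominates (suc p) (suc q) (s≤s p<q) (suc d) d' (NP.m≤m*n (suc d) (suc d'))))
  from (inj₂ (refl , d≤d')) = X≤Y⇔ .Equivalence.from (NP.+-monoʳ-≤ (suc p * M) (s≤s d≤d'))

pred-2^-≤⇔ : ∀ e f → (ℕ.pred (2 ^ e) ≤ ℕ.pred (2 ^ f)) ⇔ (e ≤ f)
pred-2^-≤⇔ e f = mk⇔ to (λ le → NP.pred-mono-≤ (NP.^-monoʳ-≤ 2 le))
  where
  to : ℕ.pred (2 ^ e) ≤ ℕ.pred (2 ^ f) → e ≤ f
  to le with NP.≤-<-connex e f
  ... | inj₁ e≤f = e≤f
  ... | inj₂ f<e =
    ⊥-elim (NP.<⇒≱ (NP.pred-mono-< {{NP.m^n≢0 2 f}} (NP.^-monoʳ-< 2 (s≤s (s≤s z≤n)) f<e)) le)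

lex-congʳ : ∀ {p e q f d d'} → (d ≤ d' ⇔ e ≤ f) → ((p , d) <ₗₑₓ (q , d')) ⇔ ((p , e) <ₗₑₓ (q , f))
lex-congʳ eq = mk⇔ (Sum.map₂ (Product.map₂ (eq .Equivalence.to)))
                   (Sum.map₂ (Product.map₂ (eq .Equivalence.from)))

cncValue-≤⇔ : ∀ p e q f → (cncValue p e ℚ.≤ cncValue q f) ⇔ ((p , e) <ₗₑₓ (q , f))
cncValue-≤⇔ p e q f = ⇔-trans (mk⇔ to from)
  (⇔-trans (mkℚᵘ-≤⇔ _ d _ d') (⇔-trans (cross-≤⇔lex p d q d') (lex-congʳ (pred-2^-≤⇔ e f))))
  where
  d = ℕ.pred (2 ^ e)
  d' = ℕ.pred (2 ^ f)
  to : cncValue p e ℚ.≤ cncValue q f → mkℚᵘ _ d ℚᵘ.≤ mkℚᵘ _ d'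
  to le = ℚᵘP.≤-respʳ-≃ (toℚᵘ-cncValue q f) (ℚᵘP.≤-respˡ-≃ (toℚᵘ-cncValue p e) (ℚP.toℚᵘ-mono-≤ le))
  from : mkℚᵘ _ d ℚᵘ.≤ mkℚᵘ _ d' → cncValue p e ℚ.≤ cncValue q f
  from le = ℚP.toℚᵘ-cancel-≤
    (ℚᵘP.≤-respʳ-≃ (ℚᵘP.≃-sym (toℚᵘ-cncValue q f)) (ℚᵘP.≤-respˡ-≃ (ℚᵘP.≃-sym (toℚᵘ-cncValue p e)) le))

module _ {Σ : Signature} where

  nodesL : List (Term Σ) → (par a pos next : ℕ) → List (NodeInfo Σ)
  nodesL ts = nodesV (V.fromList ts)

  degL : List (Term Σ) → ℕ
  degL ts = degreeV (V.fromList ts)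

  shiftPa : ℕ → NodeInfo Σ → NodeInfo Σ
  shiftPa d x = info (dec x) (pa x + d) (lp x) (paAr x)

  mutual
    length-nodesT : ∀ t next p l a → length (nodesT t next p l a) ≡ degree t
    length-nodesT leaf next p l a = refl
    length-nodesT (node s ts) next p l a = cong suc (length-nodesV ts next (ar Σ s) 1 (suc next))

    length-nodesV : ∀ {m} (ts : Vec (Term Σ) m) par a pos next → length (nodesV ts par a pos next) ≡ degreeV ts
    length-nodesV [] par a pos next = refl
    length-nodesV (t ∷ ts) par a pos next =
      trans (LP.length-++ (nodesT t next par pos a))
            (cong₂ _+_ (length-nodesT t next par pos a) (length-nodesV ts par a (suc pos) (next + degree t)))

  length-nodesL : ∀ ts par a pos next → length (nodesL ts par a pos next) ≡ degL ts
  length-nodesL ts = length-nodesV (V.fromList ts)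

  mutual
    nodesT-shift : ∀ t d next p l a → nodesT t (next + d) (p + d) l a ≡ map (shiftPa d) (nodesT t next p l a)
    nodesT-shift leaf d next p l a = refl
    nodesT-shift (node s ts) d next p l a = cong (info s (p + d) l a ∷_) (nodesV-shift ts d next (ar Σ s) 1 (suc next))

    nodesV-shift : ∀ {m} (ts : Vec (Term Σ) m) d par a pos next →
             nodesV ts (par + d) a pos (next + d) ≡ map (shiftPa d) (nodesV ts par a pos next)
    nodesV-shift [] d par a pos next = refl
    nodesV-shift (t ∷ ts) d par a pos next =
      trans (cong₂ _++_ (nodesT-shift t d next par pos a)
               (trans (cong (λ z → nodesV ts (par + d) a (suc pos) z) (xy∙z≈xz∙y next d (degree t)))
                      (nodesV-shift ts d par a (suc pos) (next + degree t))))
            (sym (LP.map-++ (shiftPa d) (nodesT t next par pos a) _))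

  liftInfo : NodeInfo Σ → NodeInfo (SN Σ)
  liftInfo x = info (inj₁ (dec x)) (pa x) (lp x) (paAr x)

  mutual
    nodesT-embed : ∀ (t : Term Σ) next p l a → nodesT (embed t) next p l a ≡ map liftInfo (nodesT t next p l a)
    nodesT-embed leaf next p l a = refl
    nodesT-embed (node s ts) next p l a = cong (info (inj₁ s) p l a ∷_) (nodesV-embed ts next (ar Σ s) 1 (suc next))

    nodesV-embed : ∀ {m} (ts : Vec (Term Σ) m) par a pos next →
           nodesV (embedV ts) par a pos next ≡ map liftInfo (nodesV ts par a pos next)
    nodesV-embed [] par a pos next = refl
    nodesV-embed (t ∷ ts) par a pos next =
      trans (cong₂ _++_ (nodesT-embed t next par pos a)
               (trans (cong (λ z → nodesV (embedV ts) par a (suc pos) (next + z)) (degree-embed t))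
                      (nodesV-embed ts par a (suc pos) (next + degree t))))
            (sym (LP.map-++ liftInfo (nodesT t next par pos a) _))

    degree-embed : ∀ (t : Term Σ) → degree (embed t) ≡ degree t
    degree-embed leaf = refl
    degree-embed (node s ts) = cong suc (degreeV-embed ts)

    degreeV-embed : ∀ {m} (ts : Vec (Term Σ) m) → degreeV (embedV ts) ≡ degreeV ts
    degreeV-embed [] = refl
    degreeV-embed (t ∷ ts) = cong₂ _+_ (degree-embed t) (degreeV-embed ts)

  nodesF : Forest Σ → List (NodeInfo Σ)
  nodesF F = nodesL F 1 (length F) 1 2

  nodes-toTerm : ∀ F → nodes (toTerm F) ≡ info (inj₂ (length F)) 1 0 (length F) ∷ map liftInfo (nodesF F)
  nodes-toTerm F = cong (info (inj₂ (length F)) 1 0 (length F) ∷_) (nodesV-embed (V.fromList F) 1 (length F) 1 2)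

  CncLe : NodeInfo Σ → NodeInfo Σ → Set
  CncLe x y = (pa x , paAr x ∸ lp x) <ₗₑₓ (pa y , paAr y ∸ lp y)

  cncVal-≤⇔ : ∀ x y → (cncVal x ℚ.≤ cncVal y) ⇔ CncLe x y
  cncVal-≤⇔ x y = cncValue-≤⇔ (pa x) (paAr x ∸ lp x) (pa y) (paAr y ∸ lp y)

  decs : List (NodeInfo Σ) → List (Sym Σ)
  decs = map dec

  dc-toTerm : ∀ F → dc (toTerm F) ≡ inj₂ (length F) ∷ map inj₁ (decs (nodesF F))
  dc-toTerm F = trans (cong (map dec) (nodes-toTerm F))
    (cong (inj₂ (length F) ∷_) (trans (sym (LP.map-∘ {g = dec} {f = liftInfo} (nodesF F))) (LP.map-∘ {g = inj₁} {f = dec} (nodesF F))))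

  cnc-toTerm : ∀ F → cnc (toTerm F) ≡ cncVal (info {Σ = SN Σ} (inj₂ (length F)) 1 0 (length F)) ∷ map cncVal (nodesF F)
  cnc-toTerm F = trans (cong (map cncVal) (nodes-toTerm F))
    (cong (cncVal (info {Σ = SN Σ} (inj₂ (length F)) 1 0 (length F)) ∷_) (sym (LP.map-∘ {g = cncVal} {f = liftInfo} (nodesF F))))

  Nodewise : (NodeInfo Σ → NodeInfo Σ → Set) → List (NodeInfo Σ) → List (NodeInfo Σ) → Set
  Nodewise R xs ys = decs xs ≡ decs ys × Pointwise R xs ys

  _≼N_ : Forest Σ → Forest Σ → Set
  F ≼N G = length F ≡ length G × Nodewise CncLe (nodesF F) (nodesF G)

  ≼F⇔≼N : ∀ F G → (F ≼F G) ⇔ (F ≼N G)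
  ≼F⇔≼N F G = mk⇔ to from
    where
    to : F ≼F G → F ≼N G
    to (d , c) with trans (sym (dc-toTerm F)) (trans d (dc-toTerm G)) | subst₂ (Pointwise ℚ._≤_) (cnc-toTerm F) (cnc-toTerm G) c
    ... | e | _ ∷ cs = SumP.inj₂-injective (cong (λ { [] → inj₂ 0 ; (x ∷ _) → x }) e)
                     , LP.map-injective SumP.inj₁-injective (cong (λ { [] → [] ; (_ ∷ xs) → xs }) e)
                     , PW.map (λ {x} {y} → Equivalence.to (cncVal-≤⇔ x y)) (PW.map⁻ cncVal cncVal cs)
    from : F ≼N G → F ≼F G
    from (eqn , eqd , cs) =
      trans (dc-toTerm F) (trans (cong₂ (λ n xs → inj₂ n ∷ map inj₁ xs) eqn eqd) (sym (dc-toTerm G))) ,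
      subst₂ (Pointwise ℚ._≤_) (sym (cnc-toTerm F)) (sym (cnc-toTerm G))
        (subst (λ n → cncVal (info {Σ = SN Σ} (inj₂ (length F)) 1 0 (length F)) ℚ.≤ cncVal (info {Σ = SN Σ} (inj₂ n) 1 0 n)) eqn
           (ℚP.≤-refl)
         ∷ PW.map⁺ cncVal cncVal (PW.map (λ {x} {y} → Equivalence.from (cncVal-≤⇔ x y)) cs))

  -- The preorder node list of a forest of size A: the children of the root occur in order,
  -- at positions c, c + 1, …, interleaved with deeper nodes (whose parent is not the root).
  data Ranked (A : ℕ) : ℕ → List (NodeInfo Σ) → Set where
    rnil  : ∀ {c} → Ranked A c []
    rtop  : ∀ {c x xs} → pa x ≡ 1 → lp x ≡ c → paAr x ≡ A → Ranked A (suc c) xs → Ranked A c (x ∷ xs)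
    rdeep : ∀ {c x xs} → 2 ≤ pa x → Ranked A c xs → Ranked A c (x ∷ xs)

  WeakCncLe : NodeInfo Σ → NodeInfo Σ → Set
  WeakCncLe x y = (pa x ≡ 1 × pa y ≡ 1) ⊎ CncLe x y

  -- At equal indices, root children in the first list sit at positions no smaller than in the second,
  -- so they are CncLe-below; WeakCncLe leaves exactly these comparisons out.
  weak⇒cncLe : ∀ {A cx cy xs ys} → Ranked A cx xs → Ranked A cy ys → cy ≤ cx →
               Pointwise WeakCncLe xs ys → Pointwise CncLe xs ys
  weak⇒cncLe rnil rnil _ [] = []
  weak⇒cncLe (rtop px lx ax rx) (rtop py ly ay ry) le (_ ∷ ws) =
    inj₂ (trans px (sym py) , subst₂ _≤_ (sym (cong₂ _∸_ ax lx)) (sym (cong₂ _∸_ ay ly)) (NP.∸-monoʳ-≤ _ le))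
    ∷ weak⇒cncLe rx ry (s≤s le) ws
  weak⇒cncLe (rtop px lx ax rx) (rdeep py ry) le (_ ∷ ws) =
    inj₁ (subst (_< _) (sym px) py) ∷ weak⇒cncLe rx ry (NP.m≤n⇒m≤1+n le) ws
  weak⇒cncLe (rdeep px rx) (rtop py ly ay ry) le (inj₁ (e , _) ∷ ws) = ⊥-elim (2≤⇒≢1 px e)
  weak⇒cncLe (rdeep px rx) (rtop py ly ay ry) le (inj₂ (inj₁ lt) ∷ ws) = ⊥-elim (2≤⇒≮[1] px lt py)
  weak⇒cncLe (rdeep px rx) (rtop py ly ay ry) le (inj₂ (inj₂ (e , _)) ∷ ws) = ⊥-elim (2≤⇒≢1 px (trans e py))
  weak⇒cncLe (rdeep px rx) (rdeep py ry) le (inj₁ (e , _) ∷ ws) = ⊥-elim (2≤⇒≢1 px e)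
  weak⇒cncLe (rdeep px rx) (rdeep py ry) le (inj₂ c ∷ ws) = c ∷ weak⇒cncLe rx ry le ws

  cncLe⇒weak : ∀ {xs ys} → Pointwise CncLe xs ys → Pointwise WeakCncLe xs ys
  cncLe⇒weak = PW.map inj₂

  RootArityVariant : NodeInfo Σ → NodeInfo Σ → Set
  RootArityVariant x' x = dec x' ≡ dec x × pa x' ≡ pa x × lp x' ≡ lp x × (pa x ≡ 1 ⊎ paAr x' ≡ paAr x)

  RootArityVariant-sym : ∀ {x' x} → RootArityVariant x' x → RootArityVariant x x'
  RootArityVariant-sym (d , p , l , inj₁ e) = sym d , sym p , sym l , inj₁ (trans p e)
  RootArityVariant-sym (d , p , l , inj₂ e) = sym d , sym p , sym l , inj₂ (sym e)

  weak-resp-variant : ∀ {x' x y' y} → RootArityVariant x' x → RootArityVariant y' y →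
                      WeakCncLe x' y' → WeakCncLe x y
  weak-resp-variant (_ , px , _ , _) (_ , py , _ , _) (inj₁ (a , b)) = inj₁ (trans (sym px) a , trans (sym py) b)
  weak-resp-variant (_ , px , _ , _) (_ , py , _ , _) (inj₂ (inj₁ lt)) = inj₂ (inj₁ (subst₂ _<_ px py lt))
  weak-resp-variant {x' = x'} {x} {y'} {y} (_ , px , lx , ax) (_ , py , ly , ay) (inj₂ (inj₂ (e , le)))
    with pa x ℕ.≟ 1
  ... | yes p1 = inj₁ (p1 , trans (sym py) (trans (sym e) (trans px p1)))
  ... | no p1 = inj₂ (inj₂ (trans (sym px) (trans e py) , subst₂ _≤_ (cong₂ _∸_ ax' lx) (cong₂ _∸_ ay' ly) le))
    where
    ax' : paAr x' ≡ paAr x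
    ax' = [ (λ q → ⊥-elim (p1 q)) , (λ q → q) ] ax
    ay' : paAr y' ≡ paAr y
    ay' = [ (λ q → ⊥-elim (p1 (trans (sym px) (trans e (trans py q))))) , (λ q → q) ] ay

  weak-resp-variant⁻ : ∀ {x x' y y'} → RootArityVariant x x' → RootArityVariant y y' →
                       WeakCncLe x' y' → WeakCncLe x y
  weak-resp-variant⁻ {x} {x'} {y} {y'} r₁ r₂ =
    weak-resp-variant {x'} {x} {y'} {y} (RootArityVariant-sym {x} {x'} r₁) (RootArityVariant-sym {y} {y'} r₂)

  -- x' is a node of a forest obtained by deleting the first k nodes of another one, and x is
  -- the same node there: a new root child hung below one of the first k + 1 nodes, any other
  -- node has its parent number shifted by k.
  Shifted′ : ℕ → NodeInfo Σ → NodeInfo Σ → Set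
  Shifted′ k x' x = dec x' ≡ dec x × ((pa x' ≡ 1 × pa x ≤ suc k) ⊎ (2 ≤ pa x' × x ≡ shiftPa k x'))

  Shifted : ℕ → NodeInfo Σ → NodeInfo Σ → Set
  Shifted k x' x = dec x' ≡ dec x × ((pa x' ≡ 1 × 1 ≤ pa x × pa x ≤ suc k) ⊎ (2 ≤ pa x' × x ≡ shiftPa k x'))

  ShiftedOver : ℕ → NodeInfo Σ → NodeInfo Σ → Set
  ShiftedOver k x' x = dec x' ≡ dec x × ((pa x' ≡ 1 × pa x ≡ 1) ⊎ (2 ≤ pa x' × x ≡ shiftPa k x'))

  shifted⇒shifted′ : ∀ {k x' x} → Shifted k x' x → Shifted′ k x' x
  shifted⇒shifted′ (d , inj₁ (a , _ , c)) = d , inj₁ (a , c)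
  shifted⇒shifted′ (d , inj₂ q) = d , inj₂ q

  shiftedOver⇒shifted′ : ∀ {k x' x} → ShiftedOver k x' x → Shifted′ k x' x
  shiftedOver⇒shifted′ (d , inj₁ (a , b)) = d , inj₁ (a , subst (_≤ _) (sym b) (s≤s z≤n))
  shiftedOver⇒shifted′ (d , inj₂ q) = d , inj₂ q

  cncLe-unshift : ∀ k (x' y' : NodeInfo Σ) → CncLe (shiftPa k x') (shiftPa k y') → CncLe x' y'
  cncLe-unshift k x' y' (inj₁ lt) = inj₁ (NP.+-cancelʳ-< k (pa x') (pa y') lt)
  cncLe-unshift k x' y' (inj₂ (e , le)) = inj₂ (NP.+-cancelʳ-≡ k (pa x') (pa y') e , le)

  cncLe-shift : ∀ k (x' y' : NodeInfo Σ) → CncLe x' y' → CncLe (shiftPa k x') (shiftPa k y')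
  cncLe-shift k x' y' (inj₁ lt) = inj₁ (NP.+-monoˡ-< k lt)
  cncLe-shift k x' y' (inj₂ (e , le)) = inj₂ (cong (_+ k) e , le)

  2+k≰n≤1+k : ∀ {n k} → 2 + k ≤ n → n ≤ suc k → ⊥
  2+k≰n≤1+k h1 h2 = NP.1+n≰n (NP.≤-trans h1 h2)

  weak-unshift : ∀ {k x' x y' y} → Shifted′ k x' x → Shifted′ k y' y → WeakCncLe x y → WeakCncLe x' y'
  weak-unshift (_ , inj₁ (a , _)) (_ , inj₁ (b , _)) w = inj₁ (a , b)
  weak-unshift (_ , inj₁ (a , _)) (_ , inj₂ (b , _)) w = inj₂ (inj₁ (subst (_< _) (sym a) b))
  weak-unshift {k} (_ , inj₂ (a , refl)) (_ , inj₁ (b , d)) (inj₁ (e , _)) =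
    ⊥-elim (2≤⇒≢1 (NP.≤-trans (NP.m≤m+n 2 k) (NP.+-monoˡ-≤ k a)) e)
  weak-unshift {k} (_ , inj₂ (a , refl)) (_ , inj₁ (b , d)) (inj₂ (inj₁ lt)) =
    ⊥-elim (2+k≰n≤1+k (NP.+-monoˡ-≤ k a) (NP.≤-trans (NP.<⇒≤ lt) d))
  weak-unshift {k} (_ , inj₂ (a , refl)) (_ , inj₁ (b , d)) (inj₂ (inj₂ (e , _))) =
    ⊥-elim (2+k≰n≤1+k (NP.+-monoˡ-≤ k a) (subst (_≤ suc k) (sym e) d))
  weak-unshift {k} (_ , inj₂ (a , refl)) (_ , inj₂ (b , refl)) (inj₁ (e , _)) =
    ⊥-elim (2≤⇒≢1 (NP.≤-trans (NP.m≤m+n 2 k) (NP.+-monoˡ-≤ k a)) e)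
  weak-unshift {k} {x'} {y' = y'} (_ , inj₂ (a , refl)) (_ , inj₂ (b , refl)) (inj₂ c) =
    inj₂ (cncLe-unshift k x' y' c)

  weak-shiftOver : ∀ {k x' x y' y} → ShiftedOver k x' x → Shifted k y' y → WeakCncLe x' y' → WeakCncLe x y
  weak-shiftOver {y = y} (_ , inj₁ (a , b)) (_ , inj₁ (c , d , e)) w with pa y ℕ.≟ 1
  ... | yes q = inj₁ (b , q)
  ... | no q = inj₂ (inj₁ (subst (_< pa y) (sym b) (NP.≤∧≢⇒< d (λ z → q (sym z)))))
  weak-shiftOver {k} (_ , inj₁ (a , b)) (_ , inj₂ (c , refl)) w =
    inj₂ (inj₁ (subst (_< _) (sym b) (NP.≤-trans (s≤s (s≤s z≤n)) (NP.+-monoˡ-≤ k c))))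
  weak-shiftOver (_ , inj₂ (a , refl)) (_ , inj₁ (c , d , e)) (inj₁ (f , _)) = ⊥-elim (2≤⇒≢1 a f)
  weak-shiftOver (_ , inj₂ (a , refl)) (_ , inj₁ (c , d , e)) (inj₂ (inj₁ lt)) = ⊥-elim (2≤⇒≮[1] a lt c)
  weak-shiftOver (_ , inj₂ (a , refl)) (_ , inj₁ (c , d , e)) (inj₂ (inj₂ (f , _))) = ⊥-elim (2≤⇒≢1 a (trans f c))
  weak-shiftOver (_ , inj₂ (a , refl)) (_ , inj₂ (c , refl)) (inj₁ (f , _)) = ⊥-elim (2≤⇒≢1 a f)
  weak-shiftOver {k} {x'} {y' = y'} (_ , inj₂ (a , refl)) (_ , inj₂ (c , refl)) (inj₂ w) =
    inj₂ (cncLe-shift k x' y' w)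

  data IsNode : Term Σ → Set where
    isn : ∀ {s ts} → IsNode (node s ts)

  data IsLeaf : Term Σ → Set where
    isl : IsLeaf leaf

  mutual
    nodesT-pa≥ : ∀ m t next p l a → m ≤ p → m ≤ next → All (λ x → m ≤ pa x) (nodesT t next p l a)
    nodesT-pa≥ m leaf next p l a hp hn = []
    nodesT-pa≥ m (node s ts) next p l a hp hn = hp ∷ nodesV-pa≥ m ts next (ar Σ s) 1 (suc next) hn (NP.m≤n⇒m≤1+n hn)

    nodesV-pa≥ : ∀ {n} m (ts : Vec (Term Σ) n) par a pos next → m ≤ par → m ≤ next →
                 All (λ x → m ≤ pa x) (nodesV ts par a pos next)
    nodesV-pa≥ m [] par a pos next hp hn = []
    nodesV-pa≥ m (t ∷ ts) par a pos next hp hn =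
      AllP.++⁺ (nodesT-pa≥ m t next par pos a hp hn)
               (nodesV-pa≥ m ts par a (suc pos) (next + degree t) hp (NP.≤-trans hn (NP.m≤m+n next (degree t))))

  nodesL-++ : ∀ (xs ys : List (Term Σ)) par a pos next →
    nodesL (xs ++ ys) par a pos next ≡ nodesL xs par a pos next ++ nodesL ys par a (length xs + pos) (next + degL xs)
  nodesL-++ [] ys par a pos next = cong (nodesL ys par a pos) (sym (NP.+-identityʳ next))
  nodesL-++ (x ∷ xs) ys par a pos next =
    trans (cong (nodesT x next par pos a ++_) (nodesL-++ xs ys par a (suc pos) (next + degree x)))
     (trans (sym (LP.++-assoc (nodesT x next par pos a) _ _))
       (cong (λ z → (nodesT x next par pos a ++ nodesL xs par a (suc pos) (next + degree x)) ++ z)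
          (cong₂ (nodesL ys par a) (NP.+-suc (length xs) pos) (NP.+-assoc next (degree x) (degL xs)))))

  nodesL-leaves : ∀ (ys : List (Term Σ)) par a pos next → All IsLeaf ys → nodesL ys par a pos next ≡ []
  nodesL-leaves [] par a pos next _ = refl
  nodesL-leaves (leaf ∷ ys) par a pos next (isl ∷ h) = nodesL-leaves ys par a (suc pos) (next + 0) h

  nodesL-++-leaves : ∀ (xs ys : List (Term Σ)) par a pos next → All IsLeaf ys →
    nodesL (xs ++ ys) par a pos next ≡ nodesL xs par a pos next
  nodesL-++-leaves xs ys par a pos next hy = begin
    nodesL (xs ++ ys) par a pos next
      ≡⟨ nodesL-++ xs ys par a pos next ⟩
    nodesL xs par a pos next ++ nodesL ys par a (length xs + pos) (next + degL xs)
      ≡⟨ cong (nodesL xs par a pos next ++_) (nodesL-leaves ys par a _ _ hy) ⟩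
    nodesL xs par a pos next ++ []
      ≡⟨ LP.++-identityʳ _ ⟩
    nodesL xs par a pos next ∎
    where open ≡-Reasoning

  ranked-deep++ : ∀ {A c} {xs ys : List (NodeInfo Σ)} → All (λ x → 2 ≤ pa x) xs → Ranked A c ys → Ranked A c (xs ++ ys)
  ranked-deep++ [] r = r
  ranked-deep++ (h ∷ hs) r = rdeep h (ranked-deep++ hs r)

  ranked-nodesL : ∀ (xs : List (Term Σ)) a pos next → All IsNode xs → 2 ≤ next → Ranked a pos (nodesL xs 1 a pos next)
  ranked-nodesL [] a pos next _ _ = rnil
  ranked-nodesL (node s ts ∷ xs) a pos next (isn ∷ h) hn =
    rtop refl refl refl (ranked-deep++ (nodesV-pa≥ 2 ts next (ar Σ s) 1 (suc next) hn (NP.m≤n⇒m≤1+n hn))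
       (ranked-nodesL xs a (suc pos) (next + suc (degreeV ts)) h (NP.≤-trans hn (NP.m≤m+n next _))))

  ranked-nodesL-++ : ∀ (xs ys : List (Term Σ)) a pos next → All IsNode xs → All IsLeaf ys → 2 ≤ next →
                     Ranked a pos (nodesL (xs ++ ys) 1 a pos next)
  ranked-nodesL-++ xs ys a pos next hx hy hn =
    subst (Ranked a pos) (sym (nodesL-++-leaves xs ys 1 a pos next hy)) (ranked-nodesL xs a pos next hx hn)

  nonLeaves-IsNode : ∀ (F : Forest Σ) → All IsNode (nonLeaves F)
  nonLeaves-IsNode [] = []
  nonLeaves-IsNode (leaf ∷ F) = nonLeaves-IsNode F
  nonLeaves-IsNode (node s us ∷ F) = isn ∷ nonLeaves-IsNode F

  leaves-IsLeaf : ∀ (F : Forest Σ) → All IsLeaf (leaves F)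
  leaves-IsLeaf [] = []
  leaves-IsLeaf (leaf ∷ F) = isl ∷ leaves-IsLeaf F
  leaves-IsLeaf (node s us ∷ F) = leaves-IsLeaf F

  ranked-leaning : ∀ (F : Forest Σ) → Leaning F → Ranked (length F) 1 (nodesF F)
  ranked-leaning F (_ , e) = subst (λ G → Ranked (length F) 1 (nodesL G 1 (length F) 1 2)) e
      (ranked-nodesL-++ (nonLeaves F) (leaves F) (length F) 1 2 (nonLeaves-IsNode F) (leaves-IsLeaf F) (s≤s (s≤s z≤n)))

  balanced⇒degL≡length : ∀ (F : Forest Σ) → Balanced F → degL F ≡ length F
  balanced⇒degL≡length F b = trans (sym (degreeV-embed (V.fromList F))) (NP.suc-injective b)

  length-nodesF : ∀ (F : Forest Σ) → Balanced F → length (nodesF F) ≡ length F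
  length-nodesF F b = trans (length-nodesL F 1 (length F) 1 2) (balanced⇒degL≡length F b)

  nodesL-variant : ∀ (xs : List (Term Σ)) a a' pos next → Pointwise RootArityVariant (nodesL xs 1 a pos next) (nodesL xs 1 a' pos next)
  nodesL-variant [] a a' pos next = []
  nodesL-variant (leaf ∷ xs) a a' pos next = nodesL-variant xs a a' (suc pos) (next + 0)
  nodesL-variant (node s us ∷ xs) a a' pos next =
    (refl , refl , refl , inj₁ refl) ∷ PW.++⁺ (PW.refl (refl , refl , refl , inj₂ refl)) (nodesL-variant xs a a' (suc pos) _)

  deep-shiftedOver : ∀ k (xs : List (NodeInfo Σ)) → All (λ x → 2 ≤ pa x) xs → Pointwise (ShiftedOver k) xs (map (shiftPa k) xs)
  deep-shiftedOver k [] [] = []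
  deep-shiftedOver k (x ∷ xs) (h ∷ hs) = (refl , inj₂ (h , refl)) ∷ deep-shiftedOver k xs hs

  nodesL-shiftedOver : ∀ (xs : List (Term Σ)) a a' pos pos' next k → 2 ≤ next →
          Pointwise (ShiftedOver k) (nodesL xs 1 a pos next) (nodesL xs 1 a' pos' (next + k))
  nodesL-shiftedOver [] a a' pos pos' next k hn = []
  nodesL-shiftedOver (t ∷ xs) a a' pos pos' next k hn =
    PW.++⁺ (tr t)
      (subst (Pointwise (ShiftedOver k) (nodesL xs 1 a (suc pos) (next + degree t)))
         (cong (nodesL xs 1 a' (suc pos')) (xy∙z≈xz∙y next (degree t) k))
         (nodesL-shiftedOver xs a a' (suc pos) (suc pos') (next + degree t) k (NP.≤-trans hn (NP.m≤m+n next (degree t)))))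
    where
    tr : ∀ u → Pointwise (ShiftedOver k) (nodesT u next 1 pos a) (nodesT u (next + k) 1 pos' a')
    tr leaf = []
    tr (node s us) = (refl , inj₁ (refl , refl)) ∷
      subst (Pointwise (ShiftedOver k) (nodesV us next (ar Σ s) 1 (suc next))) (sym (nodesV-shift us k next (ar Σ s) 1 (suc next)))
        (deep-shiftedOver k _ (nodesV-pa≥ 2 us next (ar Σ s) 1 (suc next) hn (NP.m≤n⇒m≤1+n hn)))

  nonLeaves-++ : ∀ (F G : Forest Σ) → nonLeaves (F ++ G) ≡ nonLeaves F ++ nonLeaves G
  nonLeaves-++ [] G = refl
  nonLeaves-++ (leaf ∷ F) G = nonLeaves-++ F G
  nonLeaves-++ (node s us ∷ F) G = cong (node s us ∷_) (nonLeaves-++ F G)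

  length-tlt : ∀ (F : Forest Σ) → length (tlt1 F) ≡ length F
  length-tlt F = trans (LP.length-++ (nonLeaves F)) (split F)
    where
    split : ∀ F → length (nonLeaves F) + length (leaves F) ≡ length F
    split [] = refl
    split (leaf ∷ F) = trans (NP.+-suc _ _) (cong suc (split F))
    split (node s us ∷ F) = cong suc (split F)

  nodesL-leaning : ∀ (F : Forest Σ) a pos next → Leaning F → nodesL F 1 a pos next ≡ nodesL (nonLeaves F) 1 a pos next
  nodesL-leaning F a pos next (_ , e) =
    trans (cong (λ G → nodesL G 1 a pos next) (sym e)) (nodesL-++-leaves (nonLeaves F) (leaves F) 1 a pos next (leaves-IsLeaf F))

  degL-nonLeaves : ∀ (F : Forest Σ) → degL (nonLeaves F) ≡ degL F
  degL-nonLeaves [] = refl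
  degL-nonLeaves (leaf ∷ F) = degL-nonLeaves F
  degL-nonLeaves (node s us ∷ F) = cong (suc (degreeV us) +_) (degL-nonLeaves F)

  nodesL-▷ : ∀ (F₁ F₂ : Forest Σ) a →
    nodesL (F₁ ▷ F₂) 1 a 1 2
      ≡ nodesL (nonLeaves F₁) 1 a 1 2 ++ nodesL (nonLeaves F₂) 1 a (length (nonLeaves F₁) + 1) (2 + degL F₁)
  nodesL-▷ F₁ F₂ a = begin
    nodesL (nonLeaves (F₁ ++ F₂) ++ leaves (F₁ ++ F₂)) 1 a 1 2
      ≡⟨ nodesL-++-leaves (nonLeaves (F₁ ++ F₂)) _ 1 a 1 2 (leaves-IsLeaf (F₁ ++ F₂)) ⟩
    nodesL (nonLeaves (F₁ ++ F₂)) 1 a 1 2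
      ≡⟨ cong (λ G → nodesL G 1 a 1 2) (nonLeaves-++ F₁ F₂) ⟩
    nodesL (nonLeaves F₁ ++ nonLeaves F₂) 1 a 1 2
      ≡⟨ nodesL-++ (nonLeaves F₁) (nonLeaves F₂) 1 a 1 2 ⟩
    nodesL (nonLeaves F₁) 1 a 1 2 ++ nodesL (nonLeaves F₂) 1 a (length (nonLeaves F₁) + 1) (2 + degL (nonLeaves F₁))
      ≡⟨ cong (λ z → nodesL (nonLeaves F₁) 1 a 1 2 ++ nodesL (nonLeaves F₂) 1 a (length (nonLeaves F₁) + 1) (2 + z))
              (degL-nonLeaves F₁) ⟩
    nodesL (nonLeaves F₁) 1 a 1 2 ++ nodesL (nonLeaves F₂) 1 a (length (nonLeaves F₁) + 1) (2 + degL F₁) ∎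
    where open ≡-Reasoning

  length≤degL : ∀ (xs : Forest Σ) → All IsNode xs → length xs ≤ degL xs
  length≤degL [] _ = z≤n
  length≤degL (node s us ∷ xs) (isn ∷ h) = s≤s (NP.≤-trans (length≤degL xs h) (NP.m≤n+m (degL xs) (degreeV us)))

  -- restrict F I is R padded with leaves, R the list of kept root children.
  padded : Forest Σ → ℕ → Forest Σ
  padded R m = R ++ c (m ∸ length R)

  length-padded : ∀ R m → length R ≤ m → length (padded R m) ≡ m
  length-padded R m le = trans (LP.length-++ R) (trans (cong (length R +_) (LP.length-replicate (m ∸ length R))) (NP.m+[n∸m]≡n le))

  nodesL-padded : ∀ R m a → nodesL (padded R m) 1 a 1 2 ≡ nodesL R 1 a 1 2
  nodesL-padded R m a = nodesL-++-leaves R (c (m ∸ length R)) 1 a 1 2 (AllP.replicate⁺ _ isl)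

  ranked-padded : ∀ R m → All IsNode R → Ranked (length (padded R m)) 1 (nodesF (padded R m))
  ranked-padded R m hR =
    ranked-nodesL-++ R (c (m ∸ length R)) (length (padded R m)) 1 2 hR (AllP.replicate⁺ _ isl) (s≤s (s≤s z≤n))

module _ {Σ : Signature} {R : NodeInfo Σ → NodeInfo Σ → Set} where

  decs-take : ∀ k (X Y zs : List (NodeInfo Σ)) → length X ≡ k → decs (X ++ Y) ≡ decs zs → decs X ≡ decs (take k zs)
  decs-take k X Y zs refl e = begin
    decs X                       ≡⟨ sym (take-length-++ (decs X) (decs Y)) ⟩
    take (length (decs X)) (decs X ++ decs Y) ≡⟨ cong₂ take (LP.length-map dec X) (sym (LP.map-++ dec X Y)) ⟩
    take (length X) (decs (X ++ Y)) ≡⟨ cong (take (length X)) e ⟩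
    take (length X) (decs zs)    ≡⟨ LP.take-map (length X) zs ⟩
    decs (take (length X) zs)    ∎
    where open ≡-Reasoning

  decs-drop : ∀ k (X Y zs : List (NodeInfo Σ)) → length X ≡ k → decs (X ++ Y) ≡ decs zs → decs Y ≡ decs (drop k zs)
  decs-drop k X Y zs refl e = begin
    decs Y                       ≡⟨ sym (drop-length-++ (decs X) (decs Y)) ⟩
    drop (length (decs X)) (decs X ++ decs Y) ≡⟨ cong₂ drop (LP.length-map dec X) (sym (LP.map-++ dec X Y)) ⟩
    drop (length X) (decs (X ++ Y)) ≡⟨ cong (drop (length X)) e ⟩
    drop (length X) (decs zs)    ≡⟨ LP.drop-map (length X) zs ⟩
    decs (drop (length X) zs)    ∎
    where open ≡-Reasoning

  decs-take-drop : ∀ k (X Y zs : List (NodeInfo Σ)) → decs X ≡ decs (take k zs) → decs Y ≡ decs (drop k zs) →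
                   decs (X ++ Y) ≡ decs zs
  decs-take-drop k X Y zs eX eY = begin
    decs (X ++ Y)                ≡⟨ LP.map-++ dec X Y ⟩
    decs X ++ decs Y             ≡⟨ cong₂ _++_ eX eY ⟩
    decs (take k zs) ++ decs (drop k zs) ≡⟨ sym (LP.map-++ dec (take k zs) (drop k zs)) ⟩
    decs (take k zs ++ drop k zs) ≡⟨ cong decs (LP.take++drop≡id k zs) ⟩
    decs zs                      ∎
    where open ≡-Reasoning

  Nodewise-++ˡ⁻ : ∀ k (X Y zs : List (NodeInfo Σ)) → length X ≡ k → Nodewise R (X ++ Y) zs →
                  Nodewise R X (take k zs) × Nodewise R Y (drop k zs)
  Nodewise-++ˡ⁻ k X Y zs refl (e , p) =
    (decs-take k X Y zs refl e , proj₁ (Pointwise-++ˡ⁻ X Y zs p)) , (decs-drop k X Y zs refl e , proj₂ (Pointwise-++ˡ⁻ X Y zs p))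

  Nodewise-++ʳ⁻ : ∀ k (zs X Y : List (NodeInfo Σ)) → length X ≡ k → Nodewise R zs (X ++ Y) →
                  Nodewise R (take k zs) X × Nodewise R (drop k zs) Y
  Nodewise-++ʳ⁻ k zs X Y refl (e , p) =
    (sym (decs-take k X Y zs refl (sym e)) , proj₁ (Pointwise-++ʳ⁻ zs X Y p)) ,
    (sym (decs-drop k X Y zs refl (sym e)) , proj₂ (Pointwise-++ʳ⁻ zs X Y p))

  Nodewise-++ˡ⁺ : ∀ k (X Y zs : List (NodeInfo Σ)) → Nodewise R X (take k zs) → Nodewise R Y (drop k zs) →
                  Nodewise R (X ++ Y) zs
  Nodewise-++ˡ⁺ k X Y zs (eX , pX) (eY , pY) = decs-take-drop k X Y zs eX eY , Pointwise-++ˡ⁺ zs k pX pY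

  Nodewise-++ʳ⁺ : ∀ k (zs X Y : List (NodeInfo Σ)) → Nodewise R (take k zs) X → Nodewise R (drop k zs) Y →
                  Nodewise R zs (X ++ Y)
  Nodewise-++ʳ⁺ k zs X Y (eX , pX) (eY , pY) = sym (decs-take-drop k X Y zs (sym eX) (sym eY)) , Pointwise-++ʳ⁺ zs k pX pY

decs-pointwise : ∀ {Σ} {T : NodeInfo Σ → NodeInfo Σ → Set} → (∀ {x x'} → T x x' → dec x ≡ dec x') →
                 ∀ {xs xs'} → Pointwise T xs xs' → decs xs ≡ decs xs'
decs-pointwise f p = PW.Pointwise-≡⇒≡ (PW.map⁺ dec dec (PW.map f p))

module _ {Σ : Signature} {R S : NodeInfo Σ → NodeInfo Σ → Set}
         (decR : ∀ {x x'} → R x x' → dec x ≡ dec x') (decS : ∀ {y y'} → S y y' → dec y ≡ dec y') where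

  Nodewise-push : ∀ {W W' : NodeInfo Σ → NodeInfo Σ → Set} →
                  (∀ {x x' y y'} → R x x' → S y y' → W x y → W' x' y') →
                  ∀ {xs xs' ys ys'} → Pointwise R xs xs' → Pointwise S ys ys' → Nodewise W xs ys → Nodewise W' xs' ys'
  Nodewise-push f rs ss (e , ws) =
    trans (sym (decs-pointwise decR rs)) (trans e (decs-pointwise decS ss)) , Pointwise-push f rs ss ws

  Nodewise-pull : ∀ {W W' : NodeInfo Σ → NodeInfo Σ → Set} →
                  (∀ {x x' y y'} → R x x' → S y y' → W x' y' → W' x y) →
                  ∀ {xs xs' ys ys'} → Pointwise R xs xs' → Pointwise S ys ys' → Nodewise W xs' ys' → Nodewise W' xs ys
  Nodewise-pull f rs ss (e , ws) =
    trans (decs-pointwise decR rs) (trans e (sym (decs-pointwise decS ss))) , Pointwise-pull f rs ss ws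

nodewise-weak⇒cncLe : ∀ {Σ A} {xs ys : List (NodeInfo Σ)} → Ranked A 1 xs → Ranked A 1 ys →
                      Nodewise WeakCncLe xs ys → Nodewise CncLe xs ys
nodewise-weak⇒cncLe rx ry = Product.map₂ (weak⇒cncLe rx ry NP.≤-refl)

nodewise-cncLe⇒weak : ∀ {Σ} {xs ys : List (NodeInfo Σ)} → Nodewise CncLe xs ys → Nodewise WeakCncLe xs ys
nodewise-cncLe⇒weak = Product.map₂ cncLe⇒weak

-- ⇑_k keeps the nodes numbered at most k, which form a prefix of the preorder: the restriction
-- simply truncates every tree.
module Upper {Σ : Signature} (k : ℕ) where

  keep : ℕ → Bool
  keep i = i ≤ᵇ k

  mutual
    truncT : Term Σ → ℕ → Term Σ
    truncT leaf i = leaf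
    truncT (node s ts) i = if i ≤ᵇ k then node s (truncV ts (suc i)) else leaf

    truncV : ∀ {m} → Vec (Term Σ) m → ℕ → Vec (Term Σ) m
    truncV [] j = []
    truncV (t ∷ ts) j = truncT t j ∷ truncV ts (j + degree t)

  truncL : Forest Σ → ℕ → Forest Σ
  truncL [] i = []
  truncL (t ∷ ts) i = asRootChild (truncT t i) ++ truncL ts (i + degree t)

  truncPV : ∀ {m} → Vec (Term Σ) m → ℕ → Vec (Term Σ × List (Term Σ)) m
  truncPV [] j = []
  truncPV (t ∷ ts) j = (truncT t j , []) ∷ truncPV ts (j + degree t)

  truncPV-proj₁ : ∀ {m} (ts : Vec (Term Σ) m) j → V.map proj₁ (truncPV ts j) ≡ truncV ts j
  truncPV-proj₁ [] j = refl
  truncPV-proj₁ (t ∷ ts) j = cong (truncT t j ∷_) (truncPV-proj₁ ts (j + degree t))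

  truncPV-proj₂ : ∀ {m} (ts : Vec (Term Σ) m) j → concat (V.toList (V.map proj₂ (truncPV ts j))) ≡ []
  truncPV-proj₂ [] j = refl
  truncPV-proj₂ (t ∷ ts) j = truncPV-proj₂ ts (j + degree t)

  truncT-beyond : ∀ t j → k < j → truncT t j ≡ leaf
  truncT-beyond leaf j h = refl
  truncT-beyond (node s ts) j h rewrite ≤ᵇ-false h = refl

  truncPV-detached : ∀ {m} (ts : Vec (Term Σ) m) j → k < j →
    concat (V.toList (V.map (λ p → asRootChild (proj₁ p) ++ proj₂ p) (truncPV ts j))) ≡ []
  truncPV-detached [] j h = refl
  truncPV-detached (t ∷ ts) j h rewrite truncT-beyond t j h =
    truncPV-detached ts (j + degree t) (NP.≤-trans h (NP.m≤m+n j (degree t)))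

  mutual
    restrT-trunc : ∀ t i → restrT keep t i ≡ (truncT t i , [] , i + degree t)
    restrT-trunc leaf i = cong (λ z → leaf , [] , z) (sym (NP.+-identityʳ i))
    restrT-trunc (node s ts) i rewrite restrV-trunc ts (suc i) | sym (NP.+-suc i (degreeV ts)) with i ≤ᵇ k in eq
    ... | true = cong₂ (λ a b → node s a , b , i + suc (degreeV ts)) (truncPV-proj₁ ts (suc i)) (truncPV-proj₂ ts (suc i))
    ... | false = cong (λ a → leaf , a , i + suc (degreeV ts))
                       (truncPV-detached ts (suc i) (NP.m≤n⇒m≤1+n (≤ᵇ≡false⇒> {i} {k} eq)))

    restrV-trunc : ∀ {m} (ts : Vec (Term Σ) m) j → restrV keep ts j ≡ (truncPV ts j , j + degreeV ts)
    restrV-trunc [] j = cong ([] ,_) (sym (NP.+-identityʳ j))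
    restrV-trunc (t ∷ ts) j rewrite restrT-trunc t j | restrV-trunc ts (j + degree t) =
      cong ((truncT t j , []) ∷ truncPV ts (j + degree t) ,_) (NP.+-assoc j (degree t) (degreeV ts))

  restrL-trunc : ∀ (F : Forest Σ) i → restrL keep F i ≡ truncL F i
  restrL-trunc [] i = refl
  restrL-trunc (t ∷ ts) i rewrite restrT-trunc t i = cong (asRootChild (truncT t i) ++_) (restrL-trunc ts (i + degree t))

  nodesV-truncV-beyond : ∀ {m} (ts : Vec (Term Σ) m) j → k < j → ∀ par a pos next →
                         nodesV (truncV ts j) par a pos next ≡ []
  nodesV-truncV-beyond [] j h par a pos next = refl
  nodesV-truncV-beyond (t ∷ ts) j h par a pos next rewrite truncT-beyond t j h =
    nodesV-truncV-beyond ts (j + degree t) (NP.≤-trans h (NP.m≤m+n j (degree t))) par a (suc pos) (next + 0)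

  truncL-beyond : ∀ (F : Forest Σ) i → k < i → truncL F i ≡ []
  truncL-beyond [] i h = refl
  truncL-beyond (t ∷ ts) i h rewrite truncT-beyond t i h =
    truncL-beyond ts (i + degree t) (NP.≤-trans h (NP.m≤m+n i (degree t)))

  take-nodesT-++ : ∀ (t : Term Σ) j p l a ys → take (suc k ∸ j) (nodesT t (suc j) p l a ++ ys)
    ≡ take (suc k ∸ j) (nodesT t (suc j) p l a) ++ take (suc k ∸ (j + degree t)) ys
  take-nodesT-++ t j p l a ys =
    trans (take-++ (suc k ∸ j) (nodesT t (suc j) p l a) ys)
      (cong (λ z → take (suc k ∸ j) (nodesT t (suc j) p l a) ++ take z ys)
        (trans (cong (suc k ∸ j ∸_) (length-nodesT t (suc j) p l a)) (NP.∸-+-assoc (suc k) j (degree t))))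

  mutual
    nodesT-truncT : ∀ t i p l a → nodesT (truncT t i) (suc i) p l a ≡ take (suc k ∸ i) (nodesT t (suc i) p l a)
    nodesT-truncT leaf i p l a = sym (LP.take-[] (suc k ∸ i))
    nodesT-truncT (node s ts) i p l a with i ≤ᵇ k in eq
    ... | true rewrite NP.+-∸-assoc 1 (≤ᵇ≡true⇒≤ {i} {k} eq) =
          cong (info s p l a ∷_) (nodesV-truncV ts (suc i) (suc i) (ar Σ s) 1)
    ... | false rewrite NP.m≤n⇒m∸n≡0 (≤ᵇ≡false⇒> {i} {k} eq) = refl

    nodesV-truncV : ∀ {m} (ts : Vec (Term Σ) m) j par a pos →
                    nodesV (truncV ts j) par a pos (suc j) ≡ take (suc k ∸ j) (nodesV ts par a pos (suc j))
    nodesV-truncV [] j par a pos = sym (LP.take-[] (suc k ∸ j))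
    nodesV-truncV (t ∷ ts) j par a pos with NP.≤-<-connex (j + degree t) (suc k)
    ... | inj₁ le =
      trans (cong₂ _++_ (nodesT-truncT t j par pos a)
               (trans (cong (λ z → nodesV (truncV ts (j + degree t)) par a (suc pos) (suc j + z)) (degree-truncT t j le))
                      (nodesV-truncV ts (j + degree t) par a (suc pos))))
            (sym (take-nodesT-++ t j par pos a _))
    ... | inj₂ gt =
      trans (cong₂ _++_ (nodesT-truncT t j par pos a)
                        (nodesV-truncV-beyond ts (j + degree t) (NP.<-trans (NP.n<1+n k) gt) par a (suc pos) _))
        (sym (trans (take-nodesT-++ t j par pos a rest)
                    (cong (λ z → take (suc k ∸ j) (nodesT t (suc j) par pos a) ++ take z rest) (NP.m≤n⇒m∸n≡0 (NP.<⇒≤ gt)))))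
      where rest = nodesV ts par a (suc pos) (suc j + degree t)

    degree-truncT : ∀ t j → j + degree t ≤ suc k → degree (truncT t j) ≡ degree t
    degree-truncT t j le = begin
      degree (truncT t j)                              ≡⟨ sym (length-nodesT (truncT t j) (suc j) 0 0 0) ⟩
      length (nodesT (truncT t j) (suc j) 0 0 0)       ≡⟨ cong length (nodesT-truncT t j 0 0 0) ⟩
      length (take (suc k ∸ j) (nodesT t (suc j) 0 0 0)) ≡⟨ LP.length-take (suc k ∸ j) (nodesT t (suc j) 0 0 0) ⟩
      (suc k ∸ j) ⊓ length (nodesT t (suc j) 0 0 0)    ≡⟨ cong ((suc k ∸ j) ⊓_) (length-nodesT t (suc j) 0 0 0) ⟩
      (suc k ∸ j) ⊓ degree t                           ≡⟨ NP.m≥n⇒m⊓n≡n (NP.m+n≤o⇒m≤o∸n (degree t) le′) ⟩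
      degree t                                         ∎
      where
      open ≡-Reasoning
      le′ : degree t + j ≤ suc k
      le′ = subst (_≤ suc k) (NP.+-comm j (degree t)) le

  truncL-IsNode : ∀ (F : Forest Σ) i → All IsNode (truncL F i)
  truncL-IsNode [] i = []
  truncL-IsNode (t ∷ ts) i = AllP.++⁺ (asRootChild-IsNode (truncT t i)) (truncL-IsNode ts (i + degree t))
    where
    asRootChild-IsNode : ∀ u → All IsNode (asRootChild u)
    asRootChild-IsNode leaf = []
    asRootChild-IsNode (node s us) = isn ∷ []

  truncL-++-leaves : ∀ (F G : Forest Σ) i → All IsLeaf G → truncL (F ++ G) i ≡ truncL F i
  truncL-++-leaves [] [] i _ = refl
  truncL-++-leaves [] (leaf ∷ G) i (isl ∷ h) = truncL-++-leaves [] G (i + 0) h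
  truncL-++-leaves (t ∷ F) G i h = cong (asRootChild (truncT t i) ++_) (truncL-++-leaves F G (i + degree t) h)

  asRootChild-truncT : ∀ s us i → i ≤ k → asRootChild (truncT (node s us) i) ≡ truncT (node s us) i ∷ []
  asRootChild-truncT s us i h rewrite ≤ᵇ-true h = refl

  nodesL-truncL : ∀ (A : Forest Σ) i a pos → All IsNode A →
                  nodesL (truncL A i) 1 a pos (suc i) ≡ take (suc k ∸ i) (nodesL A 1 a pos (suc i))
  nodesL-truncL [] i a pos _ = sym (LP.take-[] (suc k ∸ i))
  nodesL-truncL (t@(node s us) ∷ A) i a pos (isn ∷ h) with NP.≤-<-connex i k
  ... | inj₂ gt rewrite truncT-beyond t i gt | truncL-beyond A (i + degree t) (NP.≤-trans gt (NP.m≤m+n i (degree t)))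
                      | NP.m≤n⇒m∸n≡0 {suc k} {i} gt = refl
  ... | inj₁ le rewrite asRootChild-truncT s us i le with NP.≤-<-connex (i + degree t) (suc k)
  ...   | inj₁ le2 =
      trans (cong₂ _++_ (nodesT-truncT t i 1 pos a)
               (trans (cong (λ z → nodesL (truncL A (i + degree t)) 1 a (suc pos) (suc i + z)) (degree-truncT t i le2))
                      (nodesL-truncL A (i + degree t) a (suc pos) h)))
            (sym (take-nodesT-++ t i 1 pos a _))
  ...   | inj₂ gt =
      trans (cong₂ _++_ (nodesT-truncT t i 1 pos a)
               (cong (λ z → nodesL z 1 a (suc pos) (suc i + degree (truncT t i)))
                     (truncL-beyond A (i + degree t) (NP.<-trans (NP.n<1+n k) gt))))
        (sym (trans (take-nodesT-++ t i 1 pos a rest)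
                    (cong (λ z → take (suc k ∸ i) (nodesT t (suc i) 1 pos a) ++ take z rest) (NP.m≤n⇒m∸n≡0 (NP.<⇒≤ gt)))))
      where rest = nodesL A 1 a (suc pos) (suc i + degree t)

  countKeep-upper : ∀ n → countKeep {Σ = Σ} keep n ≡ n ⊓ k
  countKeep-upper zero = refl
  countKeep-upper (suc n) with NP.≤-<-connex (suc n) k
  ... | inj₁ le rewrite ≤ᵇ-true le | countKeep-upper n | NP.m≤n⇒m⊓n≡m (NP.≤-trans (NP.n≤1+n n) le)
                      | NP.m≤n⇒m⊓n≡m le = NP.+-comm n 1
  ... | inj₂ gt rewrite ≤ᵇ-false gt | countKeep-upper n | NP.m≥n⇒m⊓n≡n (NP.≤-pred gt)
                      | NP.m≥n⇒m⊓n≡n (NP.<⇒≤ gt) = NP.+-identityʳ k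

  module _ (F : Forest Σ) (hl : Leaning F) where

    restrL-⇑ : restrL keep F 1 ≡ truncL (nonLeaves F) 1
    restrL-⇑ = trans (restrL-trunc F 1)
      (trans (cong (λ G → truncL G 1) (sym (proj₂ hl))) (truncL-++-leaves (nonLeaves F) (leaves F) 1 (leaves-IsLeaf F)))

    nodesL-truncL-nonLeaves : ∀ a → nodesL (truncL (nonLeaves F) 1) 1 a 1 2 ≡ take k (nodesL (nonLeaves F) 1 a 1 2)
    nodesL-truncL-nonLeaves a = nodesL-truncL (nonLeaves F) 1 a 1 (nonLeaves-IsNode F)

    length-truncL-nonLeaves : length (truncL (nonLeaves F) 1) ≤ length F ⊓ k
    length-truncL-nonLeaves = begin
      length R                          ≤⟨ length≤degL R (truncL-IsNode (nonLeaves F) 1) ⟩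
      degL R                            ≡⟨ sym (length-nodesL R 1 0 1 2) ⟩
      length (nodesL R 1 0 1 2)         ≡⟨ cong length (nodesL-truncL-nonLeaves 0) ⟩
      length (take k (nodesL (nonLeaves F) 1 0 1 2)) ≡⟨ LP.length-take k (nodesL (nonLeaves F) 1 0 1 2) ⟩
      k ⊓ length (nodesL (nonLeaves F) 1 0 1 2)      ≡⟨ cong (k ⊓_) (length-nodesL (nonLeaves F) 1 0 1 2) ⟩
      k ⊓ degL (nonLeaves F)            ≡⟨ cong (k ⊓_) (trans (degL-nonLeaves F) (balanced⇒degL≡length F (proj₁ hl))) ⟩
      k ⊓ length F                      ≡⟨ NP.⊓-comm k (length F) ⟩
      length F ⊓ k                      ∎
      where
      open NP.≤-Reasoning
      R = truncL (nonLeaves F) 1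

    ⇑-padded : ⇑ k F ≡ padded (truncL (nonLeaves F) 1) (length F ⊓ k)
    ⇑-padded = cong₂ padded restrL-⇑ (countKeep-upper (length F))

    length-⇑ : length (⇑ k F) ≡ length F ⊓ k
    length-⇑ = trans (cong length ⇑-padded) (length-padded (truncL (nonLeaves F) 1) (length F ⊓ k) length-truncL-nonLeaves)

    nodesF-⇑ : Pointwise RootArityVariant (nodesF (⇑ k F)) (take k (nodesF F))
    nodesF-⇑ = subst₂ (Pointwise RootArityVariant)
      (sym (trans (cong (λ G → nodesL G 1 (length (⇑ k F)) 1 2) ⇑-padded) (nodesL-padded (truncL (nonLeaves F) 1) (length F ⊓ k) (length (⇑ k F)))))
      (trans (nodesL-truncL-nonLeaves (length F)) (cong (take k) (sym (nodesL-leaning F (length F) 1 2 hl))))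
      (nodesL-variant (truncL (nonLeaves F) 1) (length (⇑ k F)) (length F) 1 2)

    ranked-⇑ : Ranked (length (⇑ k F)) 1 (nodesF (⇑ k F))
    ranked-⇑ = subst (λ G → Ranked (length G) 1 (nodesF G)) (sym ⇑-padded)
      (ranked-padded (truncL (nonLeaves F) 1) (length F ⊓ k) (truncL-IsNode (nonLeaves F) 1))

-- ⇓_k deletes the nodes numbered at most k; the maximal subtrees hanging below them become
-- root children ("pieces"), in preorder.
module Lower {Σ : Signature} (k : ℕ) where

  keep : ℕ → Bool
  keep i = not (i ≤ᵇ k)

  mutual
    piecesT : Term Σ → ℕ → List (Term Σ)
    piecesT leaf i = []
    piecesT (node s ts) i = if i ≤ᵇ k then piecesV ts (suc i) else node s ts ∷ []

    piecesV : ∀ {m} → Vec (Term Σ) m → ℕ → List (Term Σ)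
    piecesV [] j = []
    piecesV (t ∷ ts) j = piecesT t j ++ piecesV ts (j + degree t)

  piecesL : Forest Σ → ℕ → List (Term Σ)
  piecesL ts = piecesV (V.fromList ts)

  whole : Term Σ → Term Σ × List (Term Σ)
  whole t = t , []

  orphans : ∀ {m} → Vec (Term Σ × List (Term Σ)) m → List (Term Σ)
  orphans ps = concat (V.toList (V.map (λ p → asRootChild (proj₁ p) ++ proj₂ p) ps))

  map-proj₁-whole : ∀ {m} (ts : Vec (Term Σ) m) → V.map proj₁ (V.map whole ts) ≡ ts
  map-proj₁-whole [] = refl
  map-proj₁-whole (t ∷ ts) = cong (t ∷_) (map-proj₁-whole ts)

  concat-proj₂-whole : ∀ {m} (ts : Vec (Term Σ) m) → concat (V.toList (V.map proj₂ (V.map whole ts))) ≡ []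
  concat-proj₂-whole [] = refl
  concat-proj₂-whole (t ∷ ts) = concat-proj₂-whole ts

  mutual
    restrT-kept : ∀ t i → k < i → restrT keep t i ≡ (t , [] , i + degree t)
    restrT-kept leaf i h = cong (λ z → leaf , [] , z) (sym (NP.+-identityʳ i))
    restrT-kept (node s ts) i h rewrite ≤ᵇ-false h | restrV-kept ts (suc i) (NP.m≤n⇒m≤1+n h) =
      cong₂ (λ a b → node s a , b) (map-proj₁-whole ts) (cong₂ _,_ (concat-proj₂-whole ts) (sym (NP.+-suc i (degreeV ts))))

    restrV-kept : ∀ {m} (ts : Vec (Term Σ) m) j → k < j → restrV keep ts j ≡ (V.map whole ts , j + degreeV ts)
    restrV-kept [] j h = cong ([] ,_) (sym (NP.+-identityʳ j))
    restrV-kept (t ∷ ts) j h rewrite restrT-kept t j h | restrV-kept ts (j + degree t) (NP.≤-trans h (NP.m≤m+n j (degree t))) =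
      cong ((t , []) ∷ V.map whole ts ,_) (NP.+-assoc j (degree t) (degreeV ts))

  mutual
    restrT-pieces : ∀ t i → asRootChild (proj₁ (restrT keep t i)) ++ proj₁ (proj₂ (restrT keep t i)) ≡ piecesT t i
    restrT-pieces leaf i = refl
    restrT-pieces (node s ts) i with i ≤ᵇ k in eq
    ... | true = restrV-pieces ts (suc i)
    ... | false rewrite restrV-kept ts (suc i) (NP.m≤n⇒m≤1+n (≤ᵇ≡false⇒> {i} {k} eq))
                      | map-proj₁-whole ts | concat-proj₂-whole ts = refl

    restrT-next : ∀ t i → proj₂ (proj₂ (restrT keep t i)) ≡ i + degree t
    restrT-next leaf i = sym (NP.+-identityʳ i)
    restrT-next (node s ts) i with i ≤ᵇ k in eq
    ... | true = trans (restrV-next ts (suc i)) (sym (NP.+-suc i (degreeV ts)))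
    ... | false rewrite restrV-kept ts (suc i) (NP.m≤n⇒m≤1+n (≤ᵇ≡false⇒> {i} {k} eq)) = sym (NP.+-suc i (degreeV ts))

    restrV-pieces : ∀ {m} (ts : Vec (Term Σ) m) j → orphans (proj₁ (restrV keep ts j)) ≡ piecesV ts j
    restrV-pieces [] j = refl
    restrV-pieces (t ∷ ts) j =
      cong₂ _++_ (restrT-pieces t j)
        (trans (cong (λ z → orphans (proj₁ (restrV keep ts z))) (restrT-next t j)) (restrV-pieces ts (j + degree t)))

    restrV-next : ∀ {m} (ts : Vec (Term Σ) m) j → proj₂ (restrV keep ts j) ≡ j + degreeV ts
    restrV-next [] j = sym (NP.+-identityʳ j)
    restrV-next (t ∷ ts) j = trans (cong (λ z → proj₂ (restrV keep ts z)) (restrT-next t j))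
                                   (trans (restrV-next ts (j + degree t)) (NP.+-assoc j (degree t) (degreeV ts)))

  restrL-pieces : ∀ (F : Forest Σ) i → restrL keep F i ≡ piecesL F i
  restrL-pieces [] i = refl
  restrL-pieces (t ∷ ts) i =
    trans (sym (LP.++-assoc (asRootChild (proj₁ (restrT keep t i))) _ _))
      (cong₂ _++_ (restrT-pieces t i) (trans (cong (restrL keep ts) (restrT-next t i)) (restrL-pieces ts (i + degree t))))

  -- the first number given to the nodes of the pieces of a subterm whose root has number j
  firstFree : ℕ → ℕ
  firstFree j = 2 + (j ∸ suc k)

  firstFree-≤ : ∀ i → i ≤ k → firstFree i ≡ 2
  firstFree-≤ i h = cong (2 +_) (NP.m≤n⇒m∸n≡0 (NP.m≤n⇒m≤1+n h))

  firstFree-> : ∀ i → k < i → firstFree i + k ≡ suc i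
  firstFree-> i h = cong suc (trans (sym (NP.+-suc (i ∸ suc k) k)) (NP.m∸n+n≡m h))

  firstFree-+ : ∀ j d → firstFree j + (d ∸ (suc k ∸ j)) ≡ firstFree (j + d)
  firstFree-+ j d = cong (2 +_) (m∸n+[o∸[n∸m]]≡m+o∸n j (suc k) d)

  deep-shifted : ∀ (ys : List (NodeInfo Σ)) → All (λ x → 2 ≤ pa x) ys → Pointwise (Shifted k) ys (map (shiftPa k) ys)
  deep-shifted [] [] = []
  deep-shifted (y ∷ ys) (h ∷ hs) = (refl , inj₂ (h , refl)) ∷ deep-shifted ys hs

  degL-shifted : ∀ (P : List (Term Σ)) xs c A pos' → Pointwise (Shifted k) (nodesL P 1 A pos' c) xs → degL P ≡ length xs
  degL-shifted P xs c A pos' pw = trans (sym (length-nodesL P 1 A pos' c)) (PW.Pointwise-length pw)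

  mutual
    nodesL-piecesT : ∀ t i p l a A pos → 1 ≤ p → p ≤ suc k →
      Pointwise (Shifted k) (nodesL (piecesT t i) 1 A pos (firstFree i)) (drop (suc k ∸ i) (nodesT t (suc i) p l a))
    nodesL-piecesT leaf i p l a A pos h1 hk = subst (Pointwise (Shifted k) []) (sym (LP.drop-[] (suc k ∸ i))) []
    nodesL-piecesT (node s ts) i p l a A pos h1 hk with NP.≤-<-connex i k
    ... | inj₁ le rewrite ≤ᵇ-true le | NP.+-∸-assoc 1 le | firstFree-≤ i le =
      subst (λ c → Pointwise (Shifted k) (nodesL (piecesV ts (suc i)) 1 A pos c)
                                          (drop (k ∸ i) (nodesV ts (suc i) (ar Σ s) 1 (suc (suc i)))))
        (cong (2 +_) (NP.m≤n⇒m∸n≡0 le)) (nodesL-piecesV ts (suc i) (suc i) (ar Σ s) 1 A pos (s≤s z≤n) (s≤s le))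
    ... | inj₂ gt rewrite ≤ᵇ-false gt | NP.m≤n⇒m∸n≡0 {suc k} {i} gt =
      subst (λ z → Pointwise (Shifted k) z (info s p l a ∷ nodesV ts (suc i) (ar Σ s) 1 (suc (suc i))))
            (sym (LP.++-identityʳ _))
        ((refl , inj₁ (refl , h1 , hk)) ∷
           subst (Pointwise (Shifted k) (nodesV ts (firstFree i) (ar Σ s) 1 (suc (firstFree i))))
             (trans (sym (nodesV-shift ts k (firstFree i) (ar Σ s) 1 (suc (firstFree i))))
                    (cong (λ z → nodesV ts z (ar Σ s) 1 (suc z)) (firstFree-> i gt)))
             (deep-shifted _ (nodesV-pa≥ 2 ts (firstFree i) (ar Σ s) 1 (suc (firstFree i)) (s≤s (s≤s z≤n)) (s≤s (s≤s z≤n)))))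

    nodesL-piecesV : ∀ {m} (ts : Vec (Term Σ) m) j par a pos A pos' → 1 ≤ par → par ≤ suc k →
      Pointwise (Shifted k) (nodesL (piecesV ts j) 1 A pos' (firstFree j)) (drop (suc k ∸ j) (nodesV ts par a pos (suc j)))
    nodesL-piecesV [] j par a pos A pos' h1 hk = subst (Pointwise (Shifted k) []) (sym (LP.drop-[] (suc k ∸ j))) []
    nodesL-piecesV (t ∷ ts) j par a pos A pos' h1 hk =
      subst₂ (Pointwise (Shifted k)) (sym (nodesL-++ (piecesT t j) (piecesV ts (j + degree t)) 1 A pos' (firstFree j)))
        (sym (drop-++ (suc k ∸ j) (nodesT t (suc j) par pos a) _))
        (PW.++⁺ first
          (subst₂ (λ c m' → Pointwise (Shifted k) (nodesL (piecesV ts (j + degree t)) 1 A (length (piecesT t j) + pos') c)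
                                                  (drop m' (nodesV ts par a (suc pos) (suc j + degree t))))
             (sym next-eq) (sym drop-eq)
             (nodesL-piecesV ts (j + degree t) par a (suc pos) A (length (piecesT t j) + pos') h1 hk)))
      where
      first = nodesL-piecesT t j par pos a A pos' h1 hk
      length-first : length (nodesT t (suc j) par pos a) ≡ degree t
      length-first = length-nodesT t (suc j) par pos a
      drop-eq : suc k ∸ j ∸ length (nodesT t (suc j) par pos a) ≡ suc k ∸ (j + degree t)
      drop-eq = trans (cong (suc k ∸ j ∸_) length-first) (NP.∸-+-assoc (suc k) j (degree t))
      next-eq : firstFree j + degL (piecesT t j) ≡ firstFree (j + degree t)
      next-eq = trans (cong (firstFree j +_) (trans (degL-shifted (piecesT t j) _ (firstFree j) A pos' first)
                        (trans (LP.length-drop (suc k ∸ j) (nodesT t (suc j) par pos a)) (cong (_∸ (suc k ∸ j)) length-first))))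
                      (firstFree-+ j (degree t))

  mutual
    piecesT-IsNode : ∀ t i → All IsNode (piecesT t i)
    piecesT-IsNode leaf i = []
    piecesT-IsNode (node s ts) i with i ≤ᵇ k
    ... | true = piecesV-IsNode ts (suc i)
    ... | false = isn ∷ []

    piecesV-IsNode : ∀ {m} (ts : Vec (Term Σ) m) j → All IsNode (piecesV ts j)
    piecesV-IsNode [] j = []
    piecesV-IsNode (t ∷ ts) j = AllP.++⁺ (piecesT-IsNode t j) (piecesV-IsNode ts (j + degree t))

  countKeep-lower : ∀ n → countKeep {Σ = Σ} keep n ≡ n ∸ k
  countKeep-lower zero = sym (NP.0∸n≡0 k)
  countKeep-lower (suc n) with NP.≤-<-connex (suc n) k
  ... | inj₁ le rewrite ≤ᵇ-true le | countKeep-lower n | NP.m≤n⇒m∸n≡0 (NP.≤-trans (NP.n≤1+n n) le)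
                      | NP.m≤n⇒m∸n≡0 le = refl
  ... | inj₂ gt rewrite ≤ᵇ-false gt | countKeep-lower n | NP.+-∸-assoc 1 (NP.≤-pred gt) = NP.+-comm (n ∸ k) 1

  module _ (F : Forest Σ) (hl : Leaning F) where

    nodesL-piecesL : ∀ A → Pointwise (Shifted k) (nodesL (piecesL F 1) 1 A 1 2) (drop k (nodesF F))
    nodesL-piecesL A = subst (λ c → Pointwise (Shifted k) (nodesL (piecesL F 1) 1 A 1 c) (drop k (nodesF F)))
      (cong (2 +_) (NP.0∸n≡0 k)) (nodesL-piecesV (V.fromList F) 1 1 (length F) 1 A 1 (s≤s z≤n) (s≤s z≤n))

    length-piecesL : length (piecesL F 1) ≤ length F ∸ k
    length-piecesL = begin
      length (piecesL F 1)              ≤⟨ length≤degL (piecesL F 1) (piecesV-IsNode (V.fromList F) 1) ⟩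
      degL (piecesL F 1)                ≡⟨ degL-shifted (piecesL F 1) (drop k (nodesF F)) 2 0 1 (nodesL-piecesL 0) ⟩
      length (drop k (nodesF F))        ≡⟨ LP.length-drop k (nodesF F) ⟩
      length (nodesF F) ∸ k             ≡⟨ cong (_∸ k) (length-nodesF F (proj₁ hl)) ⟩
      length F ∸ k                      ∎
      where open NP.≤-Reasoning

    ⇓-padded : ⇓ k F ≡ padded (piecesL F 1) (length F ∸ k)
    ⇓-padded = cong₂ padded (restrL-pieces F 1) (countKeep-lower (length F))

    length-⇓ : length (⇓ k F) ≡ length F ∸ k
    length-⇓ = trans (cong length ⇓-padded) (length-padded (piecesL F 1) (length F ∸ k) length-piecesL)

    nodesF-⇓ : Pointwise (Shifted k) (nodesF (⇓ k F)) (drop k (nodesF F))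
    nodesF-⇓ = subst (λ z → Pointwise (Shifted k) z (drop k (nodesF F)))
      (sym (trans (cong (λ G → nodesL G 1 (length (⇓ k F)) 1 2) ⇓-padded)
                  (nodesL-padded (piecesL F 1) (length F ∸ k) (length (⇓ k F)))))
      (nodesL-piecesL (length (⇓ k F)))

    ranked-⇓ : Ranked (length F ∸ k) 1 (nodesF (⇓ k F))
    ranked-⇓ = subst (λ z → Ranked z 1 (nodesF (⇓ k F))) length-⇓
      (subst (λ G → Ranked (length G) 1 (nodesF G)) (sym ⇓-padded)
        (ranked-padded (piecesL F 1) (length F ∸ k) (piecesV-IsNode (V.fromList F) 1)))

-- The nodes of F₁ ▷ F₂ are those of F₁ (with the arity of the root changed) followed by those of
-- F₂ with every parent number other than the root shifted by the size k of F₁.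
module Over {Σ : Signature} (F₁ F₂ : Forest Σ) (h₁ : Leaning F₁) (h₂ : Leaning F₂) where

  k = length F₁
  N = length (F₁ ▷ F₂)
  X = nodesL (nonLeaves F₁) 1 N 1 2
  Y = nodesL (nonLeaves F₂) 1 N (length (nonLeaves F₁) + 1) (2 + degL F₁)

  degL-F₁ : degL F₁ ≡ k
  degL-F₁ = balanced⇒degL≡length F₁ (proj₁ h₁)

  length-▷ : N ≡ k + length F₂
  length-▷ = trans (length-tlt (F₁ ++ F₂)) (LP.length-++ F₁)

  nodesF-▷ : nodesF (F₁ ▷ F₂) ≡ X ++ Y
  nodesF-▷ = nodesL-▷ F₁ F₂ N

  length-X : length X ≡ k
  length-X = trans (length-nodesL (nonLeaves F₁) 1 N 1 2) (trans (degL-nonLeaves F₁) degL-F₁)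

  variant-X : Pointwise RootArityVariant (nodesF F₁) X
  variant-X = subst (λ z → Pointwise RootArityVariant z X) (sym (nodesL-leaning F₁ k 1 2 h₁))
                    (nodesL-variant (nonLeaves F₁) k N 1 2)

  shiftedOver-Y : Pointwise (ShiftedOver k) (nodesF F₂) Y
  shiftedOver-Y = subst₂ (Pointwise (ShiftedOver k)) (sym (nodesL-leaning F₂ (length F₂) 1 2 h₂))
    (cong (λ z → nodesL (nonLeaves F₂) 1 N (length (nonLeaves F₁) + 1) (2 + z)) (sym degL-F₁))
    (nodesL-shiftedOver (nonLeaves F₂) (length F₂) N 1 (length (nonLeaves F₁) + 1) 2 k (s≤s (s≤s z≤n)))

  ranked-▷ : Ranked N 1 (nodesF (F₁ ▷ F₂))
  ranked-▷ = ranked-nodesL-++ (nonLeaves (F₁ ++ F₂)) (leaves (F₁ ++ F₂)) N 1 2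
    (nonLeaves-IsNode (F₁ ++ F₂)) (leaves-IsLeaf (F₁ ++ F₂)) (s≤s (s≤s z≤n))

  module _ (F : Forest Σ) (h : Leaning F) where

    ▷≼⇒≼⇑×≼⇓ : (F₁ ▷ F₂) ≼N F → (F₁ ≼N ⇑ k F) × (F₂ ≼N ⇓ k F)
    ▷≼⇒≼⇑×≼⇓ (eN , le) = (sym length-⇑k , upper) , (sym (trans (Lower.length-⇓ k F h) length-⇓k) , lower)
      where
      k≤n : k ≤ length F
      k≤n = subst (k ≤_) (trans (sym length-▷) eN) (NP.m≤m+n k (length F₂))
      length-⇑k : length (⇑ k F) ≡ k
      length-⇑k = trans (Upper.length-⇑ k F h) (NP.m≥n⇒m⊓n≡n k≤n)
      length-⇓k : length F ∸ k ≡ length F₂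
      length-⇓k = trans (cong (_∸ k) (trans (sym eN) length-▷)) (NP.m+n∸m≡n k (length F₂))
      parts = Nodewise-++ˡ⁻ k X Y (nodesF F) length-X (subst (λ z → Nodewise CncLe z (nodesF F)) nodesF-▷ le)
      upper : Nodewise CncLe (nodesF F₁) (nodesF (⇑ k F))
      upper = nodewise-weak⇒cncLe (ranked-leaning F₁ h₁) (subst (λ z → Ranked z 1 (nodesF (⇑ k F))) length-⇑k (Upper.ranked-⇑ k F h))
        (Nodewise-pull proj₁ proj₁ (weak-resp-variant⁻ {Σ = Σ})
                       variant-X (Upper.nodesF-⇑ k F h) (nodewise-cncLe⇒weak (proj₁ parts)))
      lower : Nodewise CncLe (nodesF F₂) (nodesF (⇓ k F))
      lower = nodewise-weak⇒cncLe (ranked-leaning F₂ h₂) (subst (λ z → Ranked z 1 (nodesF (⇓ k F))) length-⇓k (Lower.ranked-⇓ k F h))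
        (Nodewise-pull proj₁ proj₁ (λ r₁ r₂ → weak-unshift (shiftedOver⇒shifted′ r₁) (shifted⇒shifted′ r₂))
                       shiftedOver-Y (Lower.nodesF-⇓ k F h) (nodewise-cncLe⇒weak (proj₂ parts)))

    ≼⇑×≼⇓⇒▷≼ : (F₁ ≼N ⇑ k F) × (F₂ ≼N ⇓ k F) → (F₁ ▷ F₂) ≼N F
    ≼⇑×≼⇓⇒▷≼ ((e₁ , le₁) , (e₂ , le₂)) =
      length-eq ,
      subst (λ z → Nodewise CncLe z (nodesF F)) (sym nodesF-▷)
        (nodewise-weak⇒cncLe (subst (λ a → Ranked a 1 (X ++ Y)) length-eq (subst (Ranked N 1) nodesF-▷ ranked-▷))
                             (ranked-leaning F h)
                             (Nodewise-++ˡ⁺ k X Y (nodesF F) upper lower))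
      where
      k≤n : k ≤ length F
      k≤n = subst (_≤ length F) (sym (trans e₁ (Upper.length-⇑ k F h))) (NP.m⊓n≤m (length F) k)
      length-eq : N ≡ length F
      length-eq = trans length-▷ (trans (cong (k +_) (trans e₂ (Lower.length-⇓ k F h))) (NP.m+[n∸m]≡n k≤n))
      upper : Nodewise WeakCncLe X (take k (nodesF F))
      upper = Nodewise-push proj₁ proj₁ (weak-resp-variant {Σ = Σ}) variant-X (Upper.nodesF-⇑ k F h) (nodewise-cncLe⇒weak le₁)
      lower : Nodewise WeakCncLe Y (drop k (nodesF F))
      lower = Nodewise-push proj₁ proj₁ weak-shiftOver shiftedOver-Y (Lower.nodesF-⇓ k F h) (nodewise-cncLe⇒weak le₂)

▷≼⇔ : ∀ {Σ} (F₁ F₂ F : Forest Σ) → Leaning F₁ → Leaning F₂ → Leaning F →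
      ((F₁ ▷ F₂) ≼F F) ⇔ ((F₁ ≼F ⇑ (length F₁) F) × (F₂ ≼F ⇓ (length F₁) F))
▷≼⇔ F₁ F₂ F h₁ h₂ h = ⇔-trans (≼F⇔≼N (F₁ ▷ F₂) F)
  (⇔-trans (mk⇔ (Over.▷≼⇒≼⇑×≼⇓ F₁ F₂ h₁ h₂ F h) (Over.≼⇑×≼⇓⇒▷≼ F₁ F₂ h₁ h₂ F h))
           (⇔-sym (≼F⇔≼N F₁ (⇑ (length F₁) F)) ×-⇔ ⇔-sym (≼F⇔≼N F₂ (⇓ (length F₁) F))))
-- The nodes of a forest are computed by a stack machine reading its Polish word: the stack holds
-- the pending child slots (parent number, position, parent arity), a symbol fills the top slot and
-- pushes the slots of its children, and the counter is the number of the last node created.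
record Slot : Set where
  constructor slot
  field
    slotPa slotLp slotAr : ℕ
open Slot

slots : ℕ → ℕ → ℕ → ℕ → List Slot
slots p a pos zero = []
slots p a pos (suc m) = slot p pos a ∷ slots p a (suc pos) m

_<ₛ_ : Slot → Slot → Set
q <ₛ r = slotPa q < slotPa r ⊎ (slotPa q ≡ slotPa r × slotAr q ∸ slotLp q < slotAr r ∸ slotLp r)

_≤ₛ_ : Slot → Slot → Set
q ≤ₛ r = (slotPa q , slotAr q ∸ slotLp q) <ₗₑₓ (slotPa r , slotAr r ∸ slotLp r)

-- Stacks of the machine are strictly decreasing from the top.
Descending : List Slot → Set
Descending = AllPairs (λ q r → r <ₛ q)

<ₛ-≤ₛ-asym : ∀ r v → r <ₛ v → v ≤ₛ r → ⊥
<ₛ-≤ₛ-asym r v (inj₁ a) (inj₁ b) = NP.<-asym a b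
<ₛ-≤ₛ-asym r v (inj₁ a) (inj₂ (e , _)) = NP.<-irrefl (sym e) a
<ₛ-≤ₛ-asym r v (inj₂ (e , _)) (inj₁ b) = NP.<-irrefl (sym e) b
<ₛ-≤ₛ-asym r v (inj₂ (_ , a)) (inj₂ (_ , b)) = NP.<⇒≱ a b

<ₛ⇒≤ₛ : ∀ q r → q <ₛ r → q ≤ₛ r
<ₛ⇒≤ₛ q r (inj₁ a) = inj₁ a
<ₛ⇒≤ₛ q r (inj₂ (e , a)) = inj₂ (e , NP.<⇒≤ a)

⊆-head-≤ₛ : ∀ {x xs y ys} → (x ∷ xs) ⊆ (y ∷ ys) → Descending (y ∷ ys) → x ≤ₛ y
⊆-head-≤ₛ (refl ∷ s) _ = inj₂ (refl , NP.≤-refl)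
⊆-head-≤ₛ {x} {y = y} (_ ∷ʳ s) (a ∷ _) = <ₛ⇒≤ₛ x y (below s a)
  where
  below : ∀ {x xs ys} → (x ∷ xs) ⊆ ys → All (_<ₛ y) ys → x <ₛ y
  below (_ ∷ʳ s) (_ ∷ a) = below s a
  below (refl ∷ s) (k ∷ _) = k

⊆-after : ∀ t₁ T {u₁ T' u S'} → drop t₁ T ≡ u₁ ∷ T' → Descending T → (u ∷ S') ⊆ T → u ≤ₛ u₁ → S' ⊆ T'
⊆-after zero (v ∷ T) refl st (_ ∷ʳ s) le = SubP.∷ˡ⁻ s
⊆-after zero (v ∷ T) refl st (refl ∷ s) le = s
⊆-after (suc t) [] () st s le
⊆-after (suc t) (v ∷ T) e (_ ∷ st) (_ ∷ʳ s) le = ⊆-after t T e st s le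
⊆-after (suc t) (v ∷ T) {u₁} e (a ∷ st) (refl ∷ s) le = ⊥-elim (<ₛ-≤ₛ-asym u₁ v (drop-head t T e a) le)
  where
  drop-head : ∀ {P : Slot → Set} t T {u₁ T'} → drop t T ≡ u₁ ∷ T' → All P T → P u₁
  drop-head zero (x ∷ T) refl (p ∷ _) = p
  drop-head (suc t) (x ∷ T) e (_ ∷ a) = drop-head t T e a

slots-pa≤ : ∀ c a pos m → All (λ q → slotPa q ≤ c) (slots c a pos m)
slots-pa≤ c a pos zero = []
slots-pa≤ c a pos (suc m) = NP.≤-refl ∷ slots-pa≤ c a (suc pos) m

slots-<ₛ : ∀ c a pos l₀ m → pos < l₀ → l₀ + m ≤ suc a → All (_<ₛ slot c pos a) (slots c a l₀ m)
slots-<ₛ c a pos l₀ zero h1 h2 = []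
slots-<ₛ c a pos l₀ (suc m) h1 h2 =
  inj₂ (refl , NP.∸-monoʳ-< h1 (NP.≤-pred (NP.≤-trans (s≤s (NP.m≤m+n l₀ m)) h2′)))
  ∷ slots-<ₛ c a pos (suc l₀) m (NP.m≤n⇒m≤1+n h1) h2′
  where h2′ = NP.≤-trans (NP.≤-reflexive (sym (NP.+-suc l₀ m))) h2

descending-slots-++ : ∀ c a pos m S → All (λ q → slotPa q < c) S → Descending S → pos + m ≤ suc a →
                      Descending (slots c a pos m ++ S)
descending-slots-++ c a pos zero S hS sS h = sS
descending-slots-++ c a pos (suc m) S hS sS h =
  AllP.++⁺ (slots-<ₛ c a pos (suc pos) m NP.≤-refl h′) (All.map inj₁ hS)
  ∷ descending-slots-++ c a (suc pos) m S hS sS h′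
  where h′ = NP.≤-trans (NP.≤-reflexive (sym (NP.+-suc pos m))) h

sentinel : Slot
sentinel = slot 0 0 0

rootSlots : ℕ → List Slot
rootSlots N = slots 1 N 1 N ++ sentinel ∷ []

length-slots : ∀ p a pos m → length (slots p a pos m) ≡ m
length-slots p a pos zero = refl
length-slots p a pos (suc m) = cong suc (length-slots p a (suc pos) m)

descending-rootSlots : ∀ N → Descending (rootSlots N)
descending-rootSlots N = descending-slots-++ 1 N 1 N (sentinel ∷ []) (s≤s z≤n ∷ []) ([] ∷ []) NP.≤-refl

rootSlots-pa≤ : ∀ N → All (λ q → slotPa q ≤ 1) (rootSlots N)
rootSlots-pa≤ N = AllP.++⁺ (slots-pa≤ 1 N 1 N) (z≤n ∷ [])

module _ {Σ : Signature} where

  Word = List (Maybe (Sym Σ))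

  nothings : ℕ → Word
  nothings m = replicate m nothing

  fillSlot : Sym Σ → Slot → NodeInfo Σ
  fillSlot s q = info s (slotPa q) (slotLp q) (slotAr q)

  childSlots : ℕ → ℕ → List Slot
  childSlots c a = slots c a 1 a

  runNodes : List Slot → ℕ → Word → List (NodeInfo Σ)
  runNodes S c [] = []
  runNodes [] c (x ∷ w) = []
  runNodes (q ∷ S) c (nothing ∷ w) = runNodes S c w
  runNodes (q ∷ S) c (just s ∷ w) = fillSlot s q ∷ runNodes (childSlots (suc c) (ar Σ s) ++ S) (suc c) w

  runStack : List Slot → ℕ → Word → List Slot
  runStack S c [] = S
  runStack [] c (x ∷ w) = []
  runStack (q ∷ S) c (nothing ∷ w) = runStack S c w
  runStack (q ∷ S) c (just s ∷ w) = runStack (childSlots (suc c) (ar Σ s) ++ S) (suc c) w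

  runCount : List Slot → ℕ → Word → ℕ
  runCount S c [] = c
  runCount [] c (x ∷ w) = c
  runCount (q ∷ S) c (nothing ∷ w) = runCount S c w
  runCount (q ∷ S) c (just s ∷ w) = runCount (childSlots (suc c) (ar Σ s) ++ S) (suc c) w

  pwL : List (Term Σ) → Word
  pwL ts = pwV (V.fromList ts)

  nodesAt : List (Term Σ) → List Slot → ℕ → List (NodeInfo Σ)
  nodesAt [] Q next = []
  nodesAt (t ∷ ts) [] next = []
  nodesAt (t ∷ ts) (q ∷ Q) next = nodesT t next (slotPa q) (slotLp q) (slotAr q) ++ nodesAt ts Q (next + degree t)

  mutual
    runNodes-pw : ∀ t q X c w →
      runNodes (q ∷ X) c (pw t ++ w) ≡ nodesT t (suc c) (slotPa q) (slotLp q) (slotAr q) ++ runNodes X (c + degree t) w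
    runNodes-pw leaf q X c w = cong (λ z → runNodes X z w) (sym (NP.+-identityʳ c))
    runNodes-pw (node s ts) q X c w = cong (fillSlot s q ∷_)
      (trans (runNodes-pwV ts (suc c) (ar Σ s) 1 X (suc c) w)
             (cong (λ z → nodesV ts (suc c) (ar Σ s) 1 (suc (suc c)) ++ runNodes X z w) (sym (NP.+-suc c (degreeV ts)))))

    runNodes-pwV : ∀ {m} (ts : Vec (Term Σ) m) par a pos X c w →
         runNodes (slots par a pos m ++ X) c (pwV ts ++ w) ≡ nodesV ts par a pos (suc c) ++ runNodes X (c + degreeV ts) w
    runNodes-pwV [] par a pos X c w = cong (λ z → runNodes X z w) (sym (NP.+-identityʳ c))
    runNodes-pwV (t ∷ ts) par a pos X c w =
      trans (cong (runNodes (slot par pos a ∷ (slots par a (suc pos) _ ++ X)) c) (LP.++-assoc (pw t) (pwV ts) w))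
      (trans (runNodes-pw t (slot par pos a) (slots par a (suc pos) _ ++ X) c (pwV ts ++ w))
      (trans (cong (nodesT t (suc c) par pos a ++_) (runNodes-pwV ts par a (suc pos) X (c + degree t) w))
      (trans (sym (LP.++-assoc (nodesT t (suc c) par pos a) _ _))
        (cong (λ z → (nodesT t (suc c) par pos a ++ nodesV ts par a (suc pos) (suc (c + degree t))) ++ runNodes X z w)
              (NP.+-assoc c (degree t) (degreeV ts))))))

  mutual
    runStack-pw : ∀ t q X c w → runStack (q ∷ X) c (pw t ++ w) ≡ runStack X (c + degree t) w
    runStack-pw leaf q X c w = cong (λ z → runStack X z w) (sym (NP.+-identityʳ c))
    runStack-pw (node s ts) q X c w =
      trans (runStack-pwV ts (suc c) (ar Σ s) 1 X (suc c) w) (cong (λ z → runStack X z w) (sym (NP.+-suc c (degreeV ts))))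

    runStack-pwV : ∀ {m} (ts : Vec (Term Σ) m) par a pos X c w →
         runStack (slots par a pos m ++ X) c (pwV ts ++ w) ≡ runStack X (c + degreeV ts) w
    runStack-pwV [] par a pos X c w = cong (λ z → runStack X z w) (sym (NP.+-identityʳ c))
    runStack-pwV (t ∷ ts) par a pos X c w =
      trans (cong (runStack (slot par pos a ∷ (slots par a (suc pos) _ ++ X)) c) (LP.++-assoc (pw t) (pwV ts) w))
      (trans (runStack-pw t (slot par pos a) (slots par a (suc pos) _ ++ X) c (pwV ts ++ w))
      (trans (runStack-pwV ts par a (suc pos) X (c + degree t) w)
        (cong (λ z → runStack X z w) (NP.+-assoc c (degree t) (degreeV ts)))))

  runNodes-pwL : ∀ (ts : List (Term Σ)) Q X c w → length ts ≡ length Q →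
       runNodes (Q ++ X) c (pwL ts ++ w) ≡ nodesAt ts Q (suc c) ++ runNodes X (c + degL ts) w
  runNodes-pwL [] [] X c w e = cong (λ z → runNodes X z w) (sym (NP.+-identityʳ c))
  runNodes-pwL (t ∷ ts) (q ∷ Q) X c w e =
    trans (cong (runNodes (q ∷ (Q ++ X)) c) (LP.++-assoc (pw t) (pwL ts) w))
    (trans (runNodes-pw t q (Q ++ X) c (pwL ts ++ w))
    (trans (cong (nodesT t (suc c) (slotPa q) (slotLp q) (slotAr q) ++_) (runNodes-pwL ts Q X (c + degree t) w (NP.suc-injective e)))
    (trans (sym (LP.++-assoc (nodesT t (suc c) (slotPa q) (slotLp q) (slotAr q)) _ _))
      (cong (λ z → (nodesT t (suc c) (slotPa q) (slotLp q) (slotAr q) ++ nodesAt ts Q (suc (c + degree t))) ++ runNodes X z w)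
            (NP.+-assoc c (degree t) (degL ts))))))

  runStack-pwL : ∀ (ts : List (Term Σ)) Q X c w → length ts ≡ length Q →
       runStack (Q ++ X) c (pwL ts ++ w) ≡ runStack X (c + degL ts) w
  runStack-pwL [] [] X c w e = cong (λ z → runStack X z w) (sym (NP.+-identityʳ c))
  runStack-pwL (t ∷ ts) (q ∷ Q) X c w e =
    trans (cong (runStack (q ∷ (Q ++ X)) c) (LP.++-assoc (pw t) (pwL ts) w))
    (trans (runStack-pw t q (Q ++ X) c (pwL ts ++ w))
    (trans (runStack-pwL ts Q X (c + degree t) w (NP.suc-injective e))
      (cong (λ z → runStack X z w) (NP.+-assoc c (degree t) (degL ts)))))

  nodesAt-slots : ∀ (ts : List (Term Σ)) p a pos next → nodesAt ts (slots p a pos (length ts)) next ≡ nodesL ts p a pos next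
  nodesAt-slots [] p a pos next = refl
  nodesAt-slots (t ∷ ts) p a pos next = cong (nodesT t next p pos a ++_) (nodesAt-slots ts p a (suc pos) (next + degree t))

  runNodes-[] : ∀ c (w : Word) → runNodes [] c w ≡ []
  runNodes-[] c [] = refl
  runNodes-[] c (x ∷ w) = refl

  runStack-[] : ∀ c (w : Word) → runStack [] c w ≡ []
  runStack-[] c [] = refl
  runStack-[] c (x ∷ w) = refl

  runNodes-++ : ∀ S c (u v : Word) → runNodes S c (u ++ v) ≡ runNodes S c u ++ runNodes (runStack S c u) (runCount S c u) v
  runNodes-++ S c [] v = refl
  runNodes-++ [] c (x ∷ u) v = sym (runNodes-[] c v)
  runNodes-++ (q ∷ S) c (nothing ∷ u) v = runNodes-++ S c u v
  runNodes-++ (q ∷ S) c (just s ∷ u) v = cong (fillSlot s q ∷_) (runNodes-++ _ (suc c) u v)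

  runStack-++ : ∀ S c (u v : Word) → runStack S c (u ++ v) ≡ runStack (runStack S c u) (runCount S c u) v
  runStack-++ S c [] v = refl
  runStack-++ [] c (x ∷ u) v = sym (runStack-[] c v)
  runStack-++ (q ∷ S) c (nothing ∷ u) v = runStack-++ S c u v
  runStack-++ (q ∷ S) c (just s ∷ u) v = runStack-++ _ (suc c) u v

  runNodes-leaves : ∀ S c m → runNodes S c (nothings m) ≡ []
  runNodes-leaves S c zero = refl
  runNodes-leaves [] c (suc m) = refl
  runNodes-leaves (q ∷ S) c (suc m) = runNodes-leaves S c m

  runStack-leaves : ∀ S c m → runStack S c (nothings m) ≡ drop m S
  runStack-leaves S c zero = refl
  runStack-leaves [] c (suc m) = refl
  runStack-leaves (q ∷ S) c (suc m) = runStack-leaves S c m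

  runCount-length : ∀ S c (w : Word) → runCount S c w ≡ c + length (runNodes S c w)
  runCount-length S c [] = sym (NP.+-identityʳ c)
  runCount-length [] c (x ∷ w) = sym (NP.+-identityʳ c)
  runCount-length (q ∷ S) c (nothing ∷ w) = runCount-length S c w
  runCount-length (q ∷ S) c (just s ∷ w) = trans (runCount-length _ (suc c) w) (sym (NP.+-suc c _))

  countJust : Word → ℕ
  countJust [] = 0
  countJust (nothing ∷ w) = countJust w
  countJust (just s ∷ w) = suc (countJust w)

  length-runNodes : ∀ S c (w : Word) → length (runNodes S c w) ≤ countJust w
  length-runNodes S c [] = z≤n
  length-runNodes [] c (x ∷ w) = z≤n
  length-runNodes (q ∷ S) c (nothing ∷ w) = length-runNodes S c w
  length-runNodes (q ∷ S) c (just s ∷ w) = s≤s (length-runNodes _ (suc c) w)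

  countJust-++ : ∀ (u v : Word) → countJust (u ++ v) ≡ countJust u + countJust v
  countJust-++ [] v = refl
  countJust-++ (nothing ∷ u) v = countJust-++ u v
  countJust-++ (just s ∷ u) v = cong suc (countJust-++ u v)

  countJust-nothings : ∀ m → countJust (nothings m) ≡ 0
  countJust-nothings zero = refl
  countJust-nothings (suc m) = countJust-nothings m

  -- A word is read as blocks (a run of leaves, then a symbol), followed by the trailing leaves;
  -- for the word of a forest these are its extreme leaves.
  Block = ℕ × Sym Σ

  flat : List Block → Word
  flat [] = []
  flat ((t , s) ∷ bs) = nothings t ++ just s ∷ flat bs

  flat-++ : ∀ (bs cs : List Block) → flat (bs ++ cs) ≡ flat bs ++ flat cs
  flat-++ [] cs = refl
  flat-++ ((t , s) ∷ bs) cs = trans (cong (λ z → nothings t ++ just s ∷ z) (flat-++ bs cs))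
                                    (sym (LP.++-assoc (nothings t) (just s ∷ flat bs) (flat cs)))

  countJust-flat : ∀ (bs : List Block) → countJust (flat bs) ≡ length bs
  countJust-flat [] = refl
  countJust-flat ((t , s) ∷ bs) = trans (countJust-++ (nothings t) (just s ∷ flat bs))
                                    (trans (cong (_+ suc (countJust (flat bs))) (countJust-nothings t)) (cong suc (countJust-flat bs)))

  blocks-split : ∀ (w : Word) → ∃₂ λ bs e → w ≡ flat bs ++ nothings e
  blocks-split [] = [] , 0 , refl
  blocks-split (just s ∷ w) with blocks-split w
  ... | bs , e , eq = (0 , s) ∷ bs , e , cong (just s ∷_) eq
  blocks-split (nothing ∷ w) with blocks-split w
  ... | [] , e , eq = [] , suc e , cong (nothing ∷_) eq
  ... | (t , s) ∷ bs , e , eq = (suc t , s) ∷ bs , e , cong (nothing ∷_) eq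

  runStack-pa≤ : ∀ S c (w : Word) → All (λ q → slotPa q ≤ c) S → All (λ q → slotPa q ≤ runCount S c w) (runStack S c w)
  runStack-pa≤ S c [] h = h
  runStack-pa≤ [] c (x ∷ w) h = []
  runStack-pa≤ (q ∷ S) c (nothing ∷ w) (_ ∷ h) = runStack-pa≤ S c w h
  runStack-pa≤ (q ∷ S) c (just s ∷ w) (_ ∷ h) =
    runStack-pa≤ _ (suc c) w (AllP.++⁺ (slots-pa≤ (suc c) (ar Σ s) 1 (ar Σ s)) (All.map (λ le → NP.m≤n⇒m≤1+n le) h))

  runStack-descending : ∀ S c (w : Word) → All (λ q → slotPa q ≤ c) S → Descending S → Descending (runStack S c w)
  runStack-descending S c [] h s = s
  runStack-descending [] c (x ∷ w) h s = []
  runStack-descending (q ∷ S) c (nothing ∷ w) (_ ∷ h) (_ ∷ s) = runStack-descending S c w h s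
  runStack-descending (q ∷ S) c (just s' ∷ w) (_ ∷ h) (_ ∷ s) =
    runStack-descending _ (suc c) w (AllP.++⁺ (slots-pa≤ (suc c) (ar Σ s') 1 (ar Σ s')) (All.map (λ le → NP.m≤n⇒m≤1+n le) h))
      (descending-slots-++ (suc c) (ar Σ s') 1 (ar Σ s') S (All.map (λ le → s≤s le) h) s NP.≤-refl)

  runNodes-leaves-++ : ∀ S c t (w : Word) → runNodes S c (nothings t ++ w) ≡ runNodes (drop t S) c w
  runNodes-leaves-++ S c zero w = refl
  runNodes-leaves-++ [] c (suc t) w = sym (runNodes-[] c w)
  runNodes-leaves-++ (q ∷ S) c (suc t) w = runNodes-leaves-++ S c t w

  runStack-leaves-++ : ∀ S c t (w : Word) → runStack S c (nothings t ++ w) ≡ runStack (drop t S) c w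
  runStack-leaves-++ S c zero w = refl
  runStack-leaves-++ [] c (suc t) w = sym (runStack-[] c w)
  runStack-leaves-++ (q ∷ S) c (suc t) w = runStack-leaves-++ S c t w

  -- Reading blocks that produce CncLe-smaller nodes leaves a stack that is a sublist of the
  -- other stack: each filled slot is dominated, so the slots skipped below it are popped on both sides.
  mutual
    runStack-⊆ : ∀ (bs bs₁ : List Block) S S₁ c → S ⊆ S₁ → Descending S₁ → All (λ q → slotPa q ≤ c) S₁ →
                 length bs ≡ length bs₁ → Nodewise CncLe (runNodes S c (flat bs)) (runNodes S₁ c (flat bs₁)) →
                 runStack S c (flat bs) ⊆ runStack S₁ c (flat bs₁)
    runStack-⊆ [] [] S S₁ c sub so bd len le = sub
    runStack-⊆ ((t , s) ∷ bs) ((t₁ , s₁) ∷ bs₁) S S₁ c sub so bd len le =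
      subst₂ _⊆_ (sym (runStack-leaves-++ S c t (just s ∷ flat bs))) (sym (runStack-leaves-++ S₁ c t₁ (just s₁ ∷ flat bs₁)))
        (runStack-⊆-block bs bs₁ (drop t S) s s₁ S₁ t₁ c (⊆-trans (SubP.drop-⊆ t S) sub) so bd (NP.suc-injective len)
           (subst₂ (Nodewise CncLe) (runNodes-leaves-++ S c t (just s ∷ flat bs))
                                    (runNodes-leaves-++ S₁ c t₁ (just s₁ ∷ flat bs₁)) le))

    runStack-⊆-block : ∀ (bs bs₁ : List Block) D s s₁ S₁ t₁ c → D ⊆ S₁ → Descending S₁ → All (λ q → slotPa q ≤ c) S₁ →
                       length bs ≡ length bs₁ →
                       Nodewise CncLe (runNodes D c (just s ∷ flat bs)) (runNodes (drop t₁ S₁) c (just s₁ ∷ flat bs₁)) →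
                       runStack D c (just s ∷ flat bs) ⊆ runStack (drop t₁ S₁) c (just s₁ ∷ flat bs₁)
    runStack-⊆-block bs bs₁ [] s s₁ S₁ t₁ c sub so bd len le = minimum _
    runStack-⊆-block bs bs₁ (u ∷ S') s s₁ S₁ t₁ c sub so bd len le with drop t₁ S₁ in e
    runStack-⊆-block bs bs₁ (u ∷ S') s s₁ S₁ t₁ c sub so bd len (_ , ()) | []
    runStack-⊆-block bs bs₁ (u ∷ S') s s₁ S₁ t₁ c sub so bd len (de , u≤u₁ ∷ pw) | u₁ ∷ S₁'
      with cong (λ { [] → s ; (x ∷ _) → x }) de
    ... | refl =
      runStack-⊆ bs bs₁ (childSlots (suc c) (ar Σ s) ++ S') (childSlots (suc c) (ar Σ s) ++ S₁') (suc c)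
        (SubP.++⁺ ⊆-refl (⊆-after t₁ S₁ e so sub u≤u₁))
        (descending-slots-++ (suc c) (ar Σ s) 1 (ar Σ s) S₁' (All.map s≤s bd')
                             (AllPairs.tail (subst Descending e (AllPairsP.drop⁺ t₁ so))) NP.≤-refl)
        (AllP.++⁺ (slots-pa≤ (suc c) (ar Σ s) 1 (ar Σ s)) (All.map NP.m≤n⇒m≤1+n bd'))
        len (cong (λ { [] → [] ; (_ ∷ xs) → xs }) de , pw)
      where
      bd' : All (λ q → slotPa q ≤ c) S₁'
      bd' = All.tail (subst (All (λ q → slotPa q ≤ c)) e (AllP.drop⁺ t₁ bd))

  module _ (k : ℕ) where

    data Grafted : List Slot → List (NodeInfo Σ) → List (NodeInfo Σ) → Set where
      gnil  : ∀ {Q} → Grafted Q [] []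
      gtop  : ∀ {q Q y' ys' ys} → pa y' ≡ 1 → Grafted Q ys' ys → Grafted (q ∷ Q) (y' ∷ ys') (fillSlot (dec y') q ∷ ys)
      gdeep : ∀ {Q y' ys' ys} → 2 ≤ pa y' → Grafted Q ys' ys → Grafted Q (y' ∷ ys') (shiftPa k y' ∷ ys)

    grafted-[] : ∀ {xs' ys' ys Sr} → Pointwise (Shifted k) xs' [] → Pointwise CncLe xs' ys' → Grafted Sr ys' ys →
                 Pointwise CncLe [] ys
    grafted-[] [] [] gnil = []

    childSlots-pa≥ : ∀ c a → suc k ≤ c → All (λ q → 2 + k ≤ slotPa q) (childSlots (suc c) a)
    childSlots-pa≥ c a h = go 1 a
      where
      go : ∀ pos m → All (λ q → 2 + k ≤ slotPa q) (slots (suc c) a pos m)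
      go pos zero = []
      go pos (suc m) = s≤s h ∷ go (suc pos) m

    -- The nodes read after the prefix of F: those hung below the prefix occupy the slots of its
    -- stack (a sublist of the stack Sr of F₁), the others are deeper and shifted by k.
    suffix-cncLe : ∀ (V : Word) P SF Sr c xs' ys' ys →
          All (λ q → 2 + k ≤ slotPa q) P → All (λ q → slotPa q ≤ suc k) SF → suc k ≤ c →
          SF ⊆ Sr → Descending Sr →
          Pointwise (Shifted k) xs' (runNodes (P ++ SF) c V) →
          Pointwise CncLe xs' ys' → Grafted Sr ys' ys →
          Pointwise CncLe (runNodes (P ++ SF) c V) ys
    suffix-cncLe [] P SF Sr c xs' ys' ys hP hSF hc sub so r₁ r₂ g = grafted-[] r₁ r₂ g
    suffix-cncLe (nothing ∷ V) (p ∷ P) SF Sr c xs' ys' ys (_ ∷ hP) hSF hc sub so r₁ r₂ g =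
      suffix-cncLe V P SF Sr c xs' ys' ys hP hSF hc sub so r₁ r₂ g
    suffix-cncLe (nothing ∷ V) [] (q ∷ SF) Sr c xs' ys' ys hP (_ ∷ hSF) hc sub so r₁ r₂ g =
      suffix-cncLe V [] SF Sr c xs' ys' ys [] hSF hc (SubP.∷ˡ⁻ sub) so r₁ r₂ g
    suffix-cncLe (nothing ∷ V) [] [] Sr c xs' ys' ys hP hSF hc sub so r₁ r₂ g = grafted-[] r₁ r₂ g
    suffix-cncLe (just s ∷ V) [] [] Sr c xs' ys' ys hP hSF hc sub so r₁ r₂ g = grafted-[] r₁ r₂ g
    suffix-cncLe (just s ∷ V) (p ∷ P) SF Sr c (x' ∷ xs') (y' ∷ ys') ys (hp ∷ hP) hSF hc sub so
                 ((_ , inj₁ (_ , _ , le)) ∷ r₁) r₂ g =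
      ⊥-elim (NP.1+n≰n (NP.≤-trans hp le))
    suffix-cncLe (just s ∷ V) (p ∷ P) SF Sr c (x' ∷ xs') (y' ∷ ys') (y ∷ ys) (hp ∷ hP) hSF hc sub so
                 ((_ , inj₂ (h2 , ex)) ∷ r₁) (cl ∷ r₂) (gtop e g) =
      ⊥-elim (deep≰top cl)
      where
      deep≰top : CncLe x' y' → ⊥
      deep≰top (inj₁ lt) = 2≤⇒≮[1] h2 lt e
      deep≰top (inj₂ (eq , _)) = 2≤⇒≢1 h2 (trans eq e)
    suffix-cncLe (just s ∷ V) (p ∷ P) SF Sr c (x' ∷ xs') (y' ∷ ys') (y ∷ ys) (hp ∷ hP) hSF hc sub so
                 ((_ , inj₂ (h2 , ex)) ∷ r₁) (cl ∷ r₂) (gdeep e g) =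
      subst (λ z → CncLe z (shiftPa k y')) (sym ex) (cncLe-shift k x' y' cl)
      ∷ subst (λ z → Pointwise CncLe (runNodes z (suc c) V) ys) (LP.++-assoc children P SF)
          (suffix-cncLe V (children ++ P) SF Sr (suc c) xs' ys' ys (AllP.++⁺ (childSlots-pa≥ c (ar Σ s) hc) hP) hSF
             (NP.m≤n⇒m≤1+n hc) sub so
             (subst (λ z → Pointwise (Shifted k) xs' (runNodes z (suc c) V)) (sym (LP.++-assoc children P SF)) r₁) r₂ g)
      where children = childSlots (suc c) (ar Σ s)
    suffix-cncLe (just s ∷ V) [] (q ∷ SF) Sr c (x' ∷ xs') (y' ∷ ys') ys hP (hq ∷ hSF) hc sub so
                 ((_ , inj₂ (h2 , ex)) ∷ r₁) r₂ g =
      ⊥-elim (NP.1+n≰n (NP.≤-trans (subst (λ z → 2 + k ≤ pa z) (sym ex) (NP.+-monoˡ-≤ k h2)) hq))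
    suffix-cncLe (just s ∷ V) [] (q ∷ SF) (r ∷ Sr) c (x' ∷ xs') (y' ∷ ys') (y ∷ ys) hP (hq ∷ hSF) hc sub so
                 ((_ , inj₁ _) ∷ r₁) (cl ∷ r₂) (gtop e g) =
      ⊆-head-≤ₛ sub so
      ∷ suffix-cncLe V (childSlots (suc c) (ar Σ s)) SF Sr (suc c) xs' ys' ys (childSlots-pa≥ c (ar Σ s) hc) hSF
          (NP.m≤n⇒m≤1+n hc) (SubP.∷⁻ sub) (AllPairs.tail so) r₁ r₂ g
    suffix-cncLe (just s ∷ V) [] (q ∷ SF) Sr c (x' ∷ xs') (y' ∷ ys') (y ∷ ys) hP (hq ∷ hSF) hc sub so
                 ((_ , inj₁ _) ∷ r₁) (cl ∷ r₂) (gdeep e g) =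
      inj₁ (NP.≤-trans (s≤s hq) (NP.+-monoˡ-≤ k e))
      ∷ suffix-cncLe V (childSlots (suc c) (ar Σ s)) SF Sr (suc c) xs' ys' ys (childSlots-pa≥ c (ar Σ s) hc) hSF
          (NP.m≤n⇒m≤1+n hc) (SubP.∷ˡ⁻ sub) so r₁ r₂ g

  underOffset : Forest Σ → Forest Σ → ℕ
  underOffset F₁ F₂ = leafCount (toTerm (F₁ · c (size F₂))) ∸ extremeCount (toTerm (F₁ · c (size F₂)))

  underGraft : Forest Σ → Forest Σ → ℕ → Term Σ
  underGraft F₁ F₂ j =
    if underOffset F₁ F₂ ≤ᵇ j then nth (F₂ · c (extremeCount (toTerm F₁))) (j ∸ underOffset F₁ F₂) else leaf

  liftWord : Word → List (Maybe (Sym (SN Σ)))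
  liftWord = map (M.map inj₁)

  mutual
    pw-embed : ∀ (t : Term Σ) → pw (embed t) ≡ liftWord (pw t)
    pw-embed leaf = refl
    pw-embed (node s ts) = cong (just (inj₁ s) ∷_) (pwV-embed ts)

    pwV-embed : ∀ {m} (ts : Vec (Term Σ) m) → pwV (embedV ts) ≡ liftWord (pwV ts)
    pwV-embed [] = refl
    pwV-embed (t ∷ ts) = trans (cong₂ _++_ (pw-embed t) (pwV-embed ts)) (sym (LP.map-++ (M.map inj₁) (pw t) (pwV ts)))

  pw-toTerm : ∀ (F : Forest Σ) → pw (toTerm F) ≡ just (inj₂ (length F)) ∷ liftWord (pwL F)
  pw-toTerm F = cong (just (inj₂ (length F)) ∷_) (pwV-embed (V.fromList F))

  leadingNothings-liftWord : ∀ (v : Word) x → leadingNothings (liftWord v ++ just x ∷ []) ≡ leadingNothings v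
  leadingNothings-liftWord [] x = refl
  leadingNothings-liftWord (nothing ∷ v) x = cong suc (leadingNothings-liftWord v x)
  leadingNothings-liftWord (just s ∷ v) x = refl

  extremeCount-toTerm : ∀ (F : Forest Σ) → extremeCount (toTerm F) ≡ leadingNothings (reverse (pwL F))
  extremeCount-toTerm F = trans (cong (λ z → leadingNothings (reverse z)) (pw-toTerm F))
    (trans (cong leadingNothings (LP.unfold-reverse (just (inj₂ (length F))) (liftWord (pwL F))))
    (trans (cong (λ z → leadingNothings (z ++ just (inj₂ (length F)) ∷ [])) (sym (LP.reverse-map (M.map inj₁) (pwL F))))
       (leadingNothings-liftWord (reverse (pwL F)) (inj₂ (length F)))))

  countNothings-liftWord : ∀ (v : Word) → countNothings (liftWord v) ≡ countNothings v
  countNothings-liftWord [] = refl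
  countNothings-liftWord (nothing ∷ v) = cong suc (countNothings-liftWord v)
  countNothings-liftWord (just s ∷ v) = countNothings-liftWord v

  leafCount-toTerm : ∀ (F : Forest Σ) → leafCount (toTerm F) ≡ countNothings (pwL F)
  leafCount-toTerm F = trans (cong countNothings (pw-toTerm F)) (countNothings-liftWord (pwL F))

  countNothings-++ : ∀ (u v : Word) → countNothings (u ++ v) ≡ countNothings u + countNothings v
  countNothings-++ [] v = refl
  countNothings-++ (nothing ∷ u) v = cong suc (countNothings-++ u v)
  countNothings-++ (just s ∷ u) v = countNothings-++ u v

  countNothings-nothings : ∀ m → countNothings (nothings m) ≡ m
  countNothings-nothings zero = refl
  countNothings-nothings (suc m) = cong suc (countNothings-nothings m)

  leadingNothings-nothings-++ : ∀ m (v : Word) → leadingNothings (nothings m ++ v) ≡ m + leadingNothings v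
  leadingNothings-nothings-++ zero v = refl
  leadingNothings-nothings-++ (suc m) v = cong suc (leadingNothings-nothings-++ m v)

  reverse-nothings : ∀ m → reverse (nothings m) ≡ nothings m
  reverse-nothings zero = refl
  reverse-nothings (suc m) = trans (LP.unfold-reverse nothing (nothings m)) (trans (cong (_++ nothing ∷ []) (reverse-nothings m)) (sw m))
    where
    sw : ∀ m → nothings m ++ nothing ∷ [] ≡ nothing ∷ nothings m
    sw zero = refl
    sw (suc m) = cong (nothing ∷_) (sw m)

  leadingNothings-reverse-flat : ∀ (bs : List Block) → leadingNothings (reverse (flat bs)) ≡ 0
  leadingNothings-reverse-flat bs with lastJ bs
    where
    lastJ : ∀ (bs : List Block) → flat bs ≡ [] ⊎ ∃₂ λ u s → flat bs ≡ u ++ just s ∷ []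
    lastJ [] = inj₁ refl
    lastJ ((t , s) ∷ bs) with lastJ bs
    ... | inj₁ e = inj₂ (nothings t , s , cong (λ z → nothings t ++ just s ∷ z) e)
    ... | inj₂ (u , s' , e) = inj₂ (nothings t ++ just s ∷ u , s' ,
            trans (cong (λ z → nothings t ++ just s ∷ z) e) (sym (LP.++-assoc (nothings t) (just s ∷ u) (just s' ∷ []))))
  ... | inj₁ e = cong (λ z → leadingNothings (reverse z)) e
  ... | inj₂ (u , s , e) = trans (cong (λ z → leadingNothings (reverse z)) e) (cong leadingNothings (LP.reverse-++ u (just s ∷ [])))

  extremeCount-blocks : ∀ (bs : List Block) e → leadingNothings (reverse (flat bs ++ nothings e)) ≡ e
  extremeCount-blocks bs e = trans (cong leadingNothings (LP.reverse-++ (flat bs) (nothings e)))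
    (trans (cong (λ z → leadingNothings (z ++ reverse (flat bs))) (reverse-nothings e))
    (trans (leadingNothings-nothings-++ e (reverse (flat bs))) (trans (cong (e +_) (leadingNothings-reverse-flat bs)) (NP.+-identityʳ e))))

  module Subst (f : ℕ → Term Σ) where
    substW : Word → ℕ → Word
    substW [] j = []
    substW (nothing ∷ w) j = pw (f j) ++ substW w (suc j)
    substW (just s ∷ w) j = just s ∷ substW w j

    substW-++ : ∀ (u v : Word) j → substW (u ++ v) j ≡ substW u j ++ substW v (j + countNothings u)
    substW-++ [] v j = cong (substW v) (sym (NP.+-identityʳ j))
    substW-++ (nothing ∷ u) v j =
      trans (cong (pw (f j) ++_) (trans (substW-++ u v (suc j))
                                        (cong (λ z → substW u (suc j) ++ substW v z) (sym (NP.+-suc j _)))))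
            (sym (LP.++-assoc (pw (f j)) _ _))
    substW-++ (just s ∷ u) v j = cong (just s ∷_) (substW-++ u v j)

    mutual
      pw-substT : ∀ t j → pw (proj₁ (substT f t j)) ≡ substW (pw t) j
      pw-substT leaf j = sym (LP.++-identityʳ (pw (f j)))
      pw-substT (node s ts) j = cong (just s ∷_) (pw-substV ts j)

      substT-next : ∀ t j → proj₂ (substT f t j) ≡ j + countNothings (pw t)
      substT-next leaf j = sym (NP.+-comm j 1)
      substT-next (node s ts) j = substV-next ts j

      pw-substV : ∀ {m} (ts : Vec (Term Σ) m) j → pwV (proj₁ (substV f ts j)) ≡ substW (pwV ts) j
      pw-substV [] j = refl
      pw-substV (t ∷ ts) j =
        trans (cong₂ _++_ (pw-substT t j) (trans (cong (λ z → pwV (proj₁ (substV f ts z))) (substT-next t j)) (pw-substV ts _)))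
              (sym (substW-++ (pw t) (pwV ts) j))

      substV-next : ∀ {m} (ts : Vec (Term Σ) m) j → proj₂ (substV f ts j) ≡ j + countNothings (pwV ts)
      substV-next [] j = sym (NP.+-identityʳ j)
      substV-next (t ∷ ts) j =
        trans (cong (λ z → proj₂ (substV f ts z)) (substT-next t j))
              (trans (substV-next ts _) (trans (NP.+-assoc j _ _) (cong (j +_) (sym (countNothings-++ (pw t) (pwV ts))))))

    pwL-substL : ∀ (ts : List (Term Σ)) j → pwL (proj₁ (substL f ts j)) ≡ substW (pwL ts) j
    pwL-substL [] j = refl
    pwL-substL (t ∷ ts) j =
      trans (cong₂ _++_ (pw-substT t j) (trans (cong (λ z → pwL (proj₁ (substL f ts z))) (substT-next t j)) (pwL-substL ts _)))
            (sym (substW-++ (pw t) (pwL ts) j))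

    length-substL : ∀ (ts : List (Term Σ)) j → length (proj₁ (substL f ts j)) ≡ length ts
    length-substL [] j = refl
    length-substL (t ∷ ts) j = cong suc (length-substL ts _)

    substW-id : ∀ (u : Word) j → (∀ i → i < j + countNothings u → f i ≡ leaf) → substW u j ≡ u
    substW-id [] j h = refl
    substW-id (nothing ∷ u) j h =
      trans (cong (λ z → pw z ++ substW u (suc j)) (h j (NP.≤-trans (s≤s (NP.m≤m+n j _)) (NP.≤-reflexive (sym (NP.+-suc j _))))))
        (cong (nothing ∷_) (substW-id u (suc j) (λ i lt → h i (NP.≤-trans lt (NP.≤-reflexive (sym (NP.+-suc j _)))))))
    substW-id (just s ∷ u) j h = cong (just s ∷_) (substW-id u j h)

    substW-nothings : ∀ (G : List (Term Σ)) m j → length G ≡ m → (∀ i → f (j + i) ≡ nth G i) → substW (nothings m) j ≡ pwL G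
    substW-nothings [] zero j e h = refl
    substW-nothings (g ∷ G) (suc m) j e h =
      cong₂ _++_ (cong pw (trans (cong f (sym (NP.+-identityʳ j))) (h 0)))
                 (substW-nothings G m (suc j) (NP.suc-injective e) (λ i → trans (cong f (sym (NP.+-suc j i))) (h (suc i))))

  pwL-++ : ∀ (F G : Forest Σ) → pwL (F ++ G) ≡ pwL F ++ pwL G
  pwL-++ [] G = refl
  pwL-++ (t ∷ F) G = trans (cong (pw t ++_) (pwL-++ F G)) (sym (LP.++-assoc (pw t) (pwL F) (pwL G)))

  pwL-c : ∀ m → pwL (c m) ≡ nothings m
  pwL-c zero = refl
  pwL-c (suc m) = cong (nothing ∷_) (pwL-c m)

  nothings-+ : ∀ m n → nothings m ++ nothings n ≡ nothings (m + n)
  nothings-+ zero n = refl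
  nothings-+ (suc m) n = cong (nothing ∷_) (nothings-+ m n)

  -- The extreme leaves of F₁ · c(n₂) are its leaves numbered from cn on (cn the number of leaves in the
  -- blocks of F₁), so the grafting in F₁ ◁ F₂ keeps the blocks of F₁ and replaces its trailing leaves.
  module UnderWord (F₁ F₂ : Forest Σ) (bs : List Block) (e : ℕ) (hb : pwL F₁ ≡ flat bs ++ nothings e) where
    n2 = length F₂
    F₁·c = F₁ ++ c n2
    cn = countNothings (flat bs)
    G = F₂ ++ c e

    pwL-padded : pwL F₁·c ≡ flat bs ++ nothings (e + n2)
    pwL-padded = begin
      pwL (F₁ ++ c n2)                          ≡⟨ pwL-++ F₁ (c n2) ⟩
      pwL F₁ ++ pwL (c n2)                      ≡⟨ cong₂ _++_ hb (pwL-c n2) ⟩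
      (flat bs ++ nothings e) ++ nothings n2    ≡⟨ LP.++-assoc (flat bs) (nothings e) (nothings n2) ⟩
      flat bs ++ nothings e ++ nothings n2      ≡⟨ cong (flat bs ++_) (nothings-+ e n2) ⟩
      flat bs ++ nothings (e + n2)              ∎
      where open ≡-Reasoning

    extremeCount-F₁ : extremeCount (toTerm F₁) ≡ e
    extremeCount-F₁ =
      trans (extremeCount-toTerm F₁) (trans (cong (λ z → leadingNothings (reverse z)) hb) (extremeCount-blocks bs e))

    extremeCount-padded : extremeCount (toTerm F₁·c) ≡ e + n2
    extremeCount-padded = trans (extremeCount-toTerm F₁·c)
      (trans (cong (λ z → leadingNothings (reverse z)) pwL-padded) (extremeCount-blocks bs (e + n2)))

    leafCount-padded : leafCount (toTerm F₁·c) ≡ cn + (e + n2)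
    leafCount-padded = begin
      leafCount (toTerm F₁·c)                   ≡⟨ leafCount-toTerm F₁·c ⟩
      countNothings (pwL F₁·c)                  ≡⟨ cong countNothings pwL-padded ⟩
      countNothings (flat bs ++ nothings (e + n2)) ≡⟨ countNothings-++ (flat bs) (nothings (e + n2)) ⟩
      cn + countNothings (nothings (e + n2))    ≡⟨ cong (cn +_) (countNothings-nothings (e + n2)) ⟩
      cn + (e + n2)                             ∎
      where open ≡-Reasoning

    underOffset≡ : underOffset F₁ F₂ ≡ cn
    underOffset≡ = trans (cong₂ _∸_ leafCount-padded extremeCount-padded) (NP.m+n∸n≡m cn (e + n2))

    underGraft-< : ∀ i → i < 0 + cn → underGraft F₁ F₂ i ≡ leaf
    underGraft-< i h rewrite underOffset≡ | ≤ᵇ-false h = refl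

    underGraft-≥ : ∀ i → underGraft F₁ F₂ (0 + cn + i) ≡ nth G i
    underGraft-≥ i rewrite underOffset≡ | ≤ᵇ-true (NP.m≤m+n cn i) | NP.m+n∸m≡n cn i | extremeCount-F₁ = refl

    pwL-◁ : pwL (F₁ ◁ F₂) ≡ flat bs ++ pwL G
    pwL-◁ = begin
      pwL (F₁ ◁ F₂)                             ≡⟨ pwL-substL F₁·c 0 ⟩
      substW (pwL F₁·c) 0                       ≡⟨ cong (λ z → substW z 0) pwL-padded ⟩
      substW (flat bs ++ nothings (e + n2)) 0   ≡⟨ substW-++ (flat bs) (nothings (e + n2)) 0 ⟩
      substW (flat bs) 0 ++ substW (nothings (e + n2)) (0 + cn)
        ≡⟨ cong₂ _++_ (substW-id (flat bs) 0 underGraft-<) (substW-nothings G (e + n2) (0 + cn) length-G underGraft-≥) ⟩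
      flat bs ++ pwL G                          ∎
      where
      open ≡-Reasoning
      open Subst (underGraft F₁ F₂)
      length-G : length G ≡ e + n2
      length-G = trans (LP.length-++ F₂) (trans (cong (n2 +_) (LP.length-replicate e)) (NP.+-comm n2 e))

    length-◁ : length (F₁ ◁ F₂) ≡ length F₁ + n2
    length-◁ = trans (Subst.length-substL (underGraft F₁ F₂) F₁·c 0)
                     (trans (LP.length-++ F₁) (cong (length F₁ +_) (LP.length-replicate n2)))

  grafted-deep++ : ∀ k {Q} (xs : List (NodeInfo Σ)) {ys' ys} → All (λ x → 2 ≤ pa x) xs → Grafted k Q ys' ys →
            Grafted k Q (xs ++ ys') (map (shiftPa k) xs ++ ys)
  grafted-deep++ k [] [] g = g
  grafted-deep++ k (x ∷ xs) (h ∷ hs) g = gdeep h (grafted-deep++ k xs hs g)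

  grafted-nodesL : ∀ k (A₂ : List (Term Σ)) Q a pos next → All IsNode A₂ → length A₂ ≤ length Q → 2 ≤ next →
           Grafted k Q (nodesL A₂ 1 a pos next) (nodesAt A₂ Q (next + k))
  grafted-nodesL k [] Q a pos next _ _ _ = gnil
  grafted-nodesL k (node s us ∷ A₂) (q ∷ Q) a pos next (isn ∷ hA) (s≤s hl) hn =
    gtop refl
      (subst (λ z → Grafted k Q (nodesV us next (ar Σ s) 1 (suc next) ++ rest) (z ++ nodesAt A₂ Q (next + k + d)))
        (sym (nodesV-shift us k next (ar Σ s) 1 (suc next)))
        (grafted-deep++ k _ (nodesV-pa≥ 2 us next (ar Σ s) 1 (suc next) hn (NP.m≤n⇒m≤1+n hn))
           (subst (λ z → Grafted k Q rest (nodesAt A₂ Q z)) (xy∙z≈xz∙y next d k)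
              (grafted-nodesL k A₂ Q a (suc pos) (next + d) hA hl (NP.≤-trans hn (NP.m≤m+n next _))))))
    where
    d = suc (degreeV us)
    rest = nodesL A₂ 1 a (suc pos) (next + d)

  grafted-++ʳ : ∀ k {Q} R {ys' ys} → Grafted k Q ys' ys → Grafted k (Q ++ R) ys' ys
  grafted-++ʳ k R gnil = gnil
  grafted-++ʳ k R (gtop e g) = gtop e (grafted-++ʳ k R g)
  grafted-++ʳ k R (gdeep e g) = gdeep e (grafted-++ʳ k R g)

  nodesAt-++ : ∀ (xs ys : List (Term Σ)) Q next → length xs ≤ length Q →
              nodesAt xs Q next ++ nodesAt ys (drop (length xs) Q) (next + degL xs) ≡ nodesAt (xs ++ ys) Q next
  nodesAt-++ [] ys Q next h = cong (nodesAt ys Q) (NP.+-identityʳ next)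
  nodesAt-++ (x ∷ xs) ys (q ∷ Q) next (s≤s h) =
    trans (LP.++-assoc (nodesT x next (slotPa q) (slotLp q) (slotAr q)) _ _)
      (cong (nodesT x next (slotPa q) (slotLp q) (slotAr q) ++_)
        (trans (cong (λ z → nodesAt xs Q (next + degree x) ++ nodesAt ys (drop (length xs) Q) z) (sym (NP.+-assoc next (degree x) (degL xs))))
               (nodesAt-++ xs ys Q (next + degree x) h)))

  nodesAt-leaves : ∀ (ys : List (Term Σ)) Q next → All IsLeaf ys → nodesAt ys Q next ≡ []
  nodesAt-leaves [] Q next _ = refl
  nodesAt-leaves (y ∷ ys) [] next _ = refl
  nodesAt-leaves (leaf ∷ ys) (q ∷ Q) next (isl ∷ h) = nodesAt-leaves ys Q (next + 0) h

  grafted⇒shifted′ : ∀ k {Q ys' ys} → All (λ q → slotPa q ≤ suc k) Q → Grafted k Q ys' ys → Pointwise (Shifted′ k) ys' ys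
  grafted⇒shifted′ k hQ gnil = []
  grafted⇒shifted′ k (hq ∷ hQ) (gtop e g) = (refl , inj₁ (e , hq)) ∷ grafted⇒shifted′ k hQ g
  grafted⇒shifted′ k hQ (gdeep e g) = (refl , inj₂ (e , refl)) ∷ grafted⇒shifted′ k hQ g

  ranked-take : ∀ {A c} m {xs : List (NodeInfo Σ)} → Ranked A c xs → Ranked A c (take m xs)
  ranked-take zero r = rnil
  ranked-take (suc m) rnil = rnil
  ranked-take (suc m) (rtop a b d r) = rtop a b d (ranked-take m r)
  ranked-take (suc m) (rdeep a r) = rdeep a (ranked-take m r)

  mutual
    countJust-pw : ∀ (t : Term Σ) → countJust (pw t) ≡ degree t
    countJust-pw leaf = refl
    countJust-pw (node s ts) = cong suc (countJust-pwV ts)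

    countJust-pwV : ∀ {m} (ts : Vec (Term Σ) m) → countJust (pwV ts) ≡ degreeV ts
    countJust-pwV [] = refl
    countJust-pwV (t ∷ ts) = trans (countJust-++ (pw t) (pwV ts)) (cong₂ _+_ (countJust-pw t) (countJust-pwV ts))

  countJust-pwL : ∀ (ts : List (Term Σ)) → countJust (pwL ts) ≡ degL ts
  countJust-pwL ts = countJust-pwV (V.fromList ts)

  nodesL-run : ∀ (G : Forest Σ) a → length G ≡ a → nodesL G 1 a 1 2 ≡ runNodes (rootSlots a) 1 (pwL G)
  nodesL-run G a e = sym (begin
    runNodes (rootSlots a) 1 (pwL G)
      ≡⟨ cong (runNodes (rootSlots a) 1) (sym (LP.++-identityʳ (pwL G))) ⟩
    runNodes (slots 1 a 1 a ++ sentinel ∷ []) 1 (pwL G ++ [])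
      ≡⟨ runNodes-pwL G (slots 1 a 1 a) (sentinel ∷ []) 1 [] (trans e (sym (length-slots 1 a 1 a))) ⟩
    nodesAt G (slots 1 a 1 a) 2 ++ []
      ≡⟨ LP.++-identityʳ _ ⟩
    nodesAt G (slots 1 a 1 a) 2
      ≡⟨ subst (λ m → nodesAt G (slots 1 a 1 m) 2 ≡ nodesL G 1 a 1 2) e (nodesAt-slots G 1 a 1 2) ⟩
    nodesL G 1 a 1 2 ∎)
    where open ≡-Reasoning

  runStack-forest : ∀ (G : Forest Σ) a → length G ≡ a → runStack (rootSlots a) 1 (pwL G) ≡ sentinel ∷ []
  runStack-forest G a e = trans (cong (runStack (rootSlots a) 1) (sym (LP.++-identityʳ (pwL G))))
    (runStack-pwL G (slots 1 a 1 a) (sentinel ∷ []) 1 [] (trans e (sym (length-slots 1 a 1 a))))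

  length-blocks : ∀ (G : Forest Σ) bs e → pwL G ≡ flat bs ++ nothings e → length bs ≡ degL G
  length-blocks G bs e eq = begin
    length bs                               ≡⟨ sym (countJust-flat bs) ⟩
    countJust (flat bs)                     ≡⟨ sym (NP.+-identityʳ _) ⟩
    countJust (flat bs) + 0                 ≡⟨ cong (countJust (flat bs) +_) (sym (countJust-nothings e)) ⟩
    countJust (flat bs) + countJust (nothings e) ≡⟨ sym (countJust-++ (flat bs) (nothings e)) ⟩
    countJust (flat bs ++ nothings e)       ≡⟨ cong countJust (sym eq) ⟩
    countJust (pwL G)                       ≡⟨ countJust-pwL G ⟩
    degL G                                  ∎
    where open ≡-Reasoning

  module PrefixRun (G : Forest Σ) (hG : Balanced G) (N k : ℕ) (eqN : length G ≡ N) (k≤ : k ≤ length G) where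

    bs = proj₁ (blocks-split (pwL G))
    e = proj₁ (proj₂ (blocks-split (pwL G)))

    pwL-G : pwL G ≡ flat bs ++ nothings e
    pwL-G = proj₂ (proj₂ (blocks-split (pwL G)))

    length-bs : length bs ≡ length G
    length-bs = trans (length-blocks G bs e pwL-G) (balanced⇒degL≡length G hG)

    prefix = take k bs
    suffix = flat (drop k bs) ++ nothings e
    X = runNodes (rootSlots N) 1 (flat prefix)
    Y = runStack (rootSlots N) 1 (flat prefix)
    R = runNodes Y (runCount (rootSlots N) 1 (flat prefix)) suffix

    length-prefix : length prefix ≡ k
    length-prefix = trans (LP.length-take k bs) (trans (cong (k ⊓_) length-bs) (NP.m≤n⇒m⊓n≡m k≤))

    pwL-split : pwL G ≡ flat prefix ++ suffix
    pwL-split = begin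
      pwL G                                          ≡⟨ pwL-G ⟩
      flat bs ++ nothings e                          ≡⟨ cong (λ z → flat z ++ nothings e) (sym (LP.take++drop≡id k bs)) ⟩
      flat (prefix ++ drop k bs) ++ nothings e       ≡⟨ cong (_++ nothings e) (flat-++ prefix (drop k bs)) ⟩
      (flat prefix ++ flat (drop k bs)) ++ nothings e ≡⟨ LP.++-assoc (flat prefix) (flat (drop k bs)) (nothings e) ⟩
      flat prefix ++ suffix                          ∎
      where open ≡-Reasoning

    nodesF-split : nodesF G ≡ X ++ R
    nodesF-split = trans (cong (λ a → nodesL G 1 a 1 2) eqN)
      (trans (nodesL-run G N eqN) (trans (cong (runNodes (rootSlots N) 1) pwL-split) (runNodes-++ (rootSlots N) 1 (flat prefix) suffix)))

    length-X≤ : length X ≤ k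
    length-X≤ = NP.≤-trans (length-runNodes (rootSlots N) 1 (flat prefix))
                           (NP.≤-reflexive (trans (countJust-flat prefix) length-prefix))

    length-R≤ : length R ≤ length G ∸ k
    length-R≤ = NP.≤-trans (length-runNodes Y _ suffix) (NP.≤-reflexive (begin
      countJust suffix                                     ≡⟨ countJust-++ (flat (drop k bs)) (nothings e) ⟩
      countJust (flat (drop k bs)) + countJust (nothings e) ≡⟨ cong₂ _+_ (countJust-flat (drop k bs)) (countJust-nothings e) ⟩
      length (drop k bs) + 0                               ≡⟨ NP.+-identityʳ _ ⟩
      length (drop k bs)                                   ≡⟨ LP.length-drop k bs ⟩
      length bs ∸ k                                        ≡⟨ cong (_∸ k) length-bs ⟩
      length G ∸ k                                         ∎))
      where open ≡-Reasoning

    -- Both parts are bounded and together contain all length G nodes.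
    length-X : length X ≡ k
    length-X = NP.≤-antisym length-X≤ (begin
      k                       ≡⟨ sym (NP.m∸[m∸n]≡n k≤) ⟩
      length G ∸ (length G ∸ k) ≤⟨ NP.∸-monoʳ-≤ (length G) length-R≤ ⟩
      length G ∸ length R     ≡⟨ cong (_∸ length R) (sym length-X+R) ⟩
      (length X + length R) ∸ length R ≡⟨ NP.m+n∸n≡m (length X) (length R) ⟩
      length X                ∎)
      where
      open NP.≤-Reasoning
      length-X+R : length X + length R ≡ length G
      length-X+R = trans (sym (LP.length-++ X)) (trans (cong length (sym nodesF-split)) (length-nodesF G hG))

    runCount-prefix : runCount (rootSlots N) 1 (flat prefix) ≡ suc k
    runCount-prefix = trans (runCount-length (rootSlots N) 1 (flat prefix)) (cong suc length-X)

    take-nodesF : take k (nodesF G) ≡ X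
    take-nodesF = trans (cong (take k) nodesF-split) (trans (cong (λ m → take m (X ++ R)) (sym length-X)) (take-length-++ X R))

    drop-nodesF : drop k (nodesF G) ≡ runNodes Y (suc k) suffix
    drop-nodesF = trans (cong (drop k) nodesF-split)
      (trans (cong (λ m → drop m (X ++ R)) (sym length-X))
             (trans (drop-length-++ X R) (cong (λ m → runNodes Y m suffix) runCount-prefix)))

    Y-pa≤ : All (λ q → slotPa q ≤ suc k) Y
    Y-pa≤ = subst (λ m → All (λ q → slotPa q ≤ m) Y) runCount-prefix (runStack-pa≤ (rootSlots N) 1 (flat prefix) (rootSlots-pa≤ N))

  -- The nodes of F₁ ◁ F₂ are those of F₁ (with the root arity changed), followed by those of F₂
  -- with its trees grafted onto the slots left open by F₁, i.e. onto its extreme leaves.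
  module Under (F₁ F₂ : Forest Σ) (h₁ : Leaning F₁) (h₂ : Leaning F₂) where

    k = length F₁
    bs = proj₁ (blocks-split (pwL F₁))
    e = proj₁ (proj₂ (blocks-split (pwL F₁)))

    pwL-F₁ : pwL F₁ ≡ flat bs ++ nothings e
    pwL-F₁ = proj₂ (proj₂ (blocks-split (pwL F₁)))

    open UnderWord F₁ F₂ bs e pwL-F₁ using (F₁·c; G; pwL-padded; pwL-◁; length-◁)

    N = length (F₁ ◁ F₂)
    X = runNodes (rootSlots N) 1 (flat bs)
    Y = runStack (rootSlots N) 1 (flat bs)
    Q = take (e + length F₂) Y
    Z = nodesAt (nonLeaves F₂) Q (2 + k)

    length-F₁·c : length F₁·c ≡ N
    length-F₁·c = trans (LP.length-++ F₁) (trans (cong (k +_) (LP.length-replicate (length F₂))) (sym length-◁))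

    X≡ : X ≡ nodesL F₁ 1 N 1 2
    X≡ = begin
      X                                             ≡⟨ sym (LP.++-identityʳ X) ⟩
      X ++ []                                       ≡⟨ cong (X ++_) (sym (runNodes-leaves Y _ (e + length F₂))) ⟩
      X ++ runNodes Y _ (nothings (e + length F₂))  ≡⟨ sym (runNodes-++ (rootSlots N) 1 (flat bs) (nothings (e + length F₂))) ⟩
      runNodes (rootSlots N) 1 (flat bs ++ nothings (e + length F₂)) ≡⟨ cong (runNodes (rootSlots N) 1) (sym pwL-padded) ⟩
      runNodes (rootSlots N) 1 (pwL F₁·c)           ≡⟨ sym (nodesL-run F₁·c N length-F₁·c) ⟩
      nodesL F₁·c 1 N 1 2                           ≡⟨ nodesL-++-leaves F₁ (c (length F₂)) 1 N 1 2 (AllP.replicate⁺ _ isl) ⟩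
      nodesL F₁ 1 N 1 2                             ∎
      where open ≡-Reasoning

    drop-Y : drop (e + length F₂) Y ≡ sentinel ∷ []
    drop-Y = begin
      drop (e + length F₂) Y                         ≡⟨ sym (runStack-leaves Y _ (e + length F₂)) ⟩
      runStack Y _ (nothings (e + length F₂))        ≡⟨ sym (runStack-++ (rootSlots N) 1 (flat bs) (nothings (e + length F₂))) ⟩
      runStack (rootSlots N) 1 (flat bs ++ nothings (e + length F₂)) ≡⟨ cong (runStack (rootSlots N) 1) (sym pwL-padded) ⟩
      runStack (rootSlots N) 1 (pwL F₁·c)            ≡⟨ runStack-forest F₁·c N length-F₁·c ⟩
      sentinel ∷ []                                  ∎
      where open ≡-Reasoning

    Y≡ : Y ≡ Q ++ sentinel ∷ []
    Y≡ = trans (sym (LP.take++drop≡id (e + length F₂) Y)) (cong (Q ++_) drop-Y)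

    length-Q : length Q ≡ e + length F₂
    length-Q = trans (LP.length-take (e + length F₂) Y)
      (trans (cong ((e + length F₂) ⊓_) (drop≡singleton⇒length (e + length F₂) Y drop-Y)) (NP.m≤n⇒m⊓n≡m (NP.m≤m+n (e + length F₂) 1)))

    length-X : length X ≡ k
    length-X = trans (cong length X≡) (trans (length-nodesL F₁ 1 N 1 2) (balanced⇒degL≡length F₁ (proj₁ h₁)))

    runCount-X : runCount (rootSlots N) 1 (flat bs) ≡ suc k
    runCount-X = trans (runCount-length (rootSlots N) 1 (flat bs)) (cong suc length-X)

    nonLeaves-F₂≤Q : length (nonLeaves F₂) ≤ length Q
    nonLeaves-F₂≤Q = begin
      length (nonLeaves F₂)                          ≤⟨ NP.m≤m+n (length (nonLeaves F₂)) (length (leaves F₂)) ⟩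
      length (nonLeaves F₂) + length (leaves F₂)     ≡⟨ sym (LP.length-++ (nonLeaves F₂)) ⟩
      length (tlt1 F₂)                               ≡⟨ cong length (proj₂ h₂) ⟩
      length F₂                                      ≤⟨ NP.m≤n+m (length F₂) e ⟩
      e + length F₂                                  ≡⟨ sym length-Q ⟩
      length Q                                       ∎
      where open NP.≤-Reasoning

    nodesAt-G : nodesAt G Q (2 + k) ≡ Z
    nodesAt-G = begin
      nodesAt (F₂ ++ c e) Q (2 + k)                  ≡⟨ cong (λ z → nodesAt (z ++ c e) Q (2 + k)) (sym (proj₂ h₂)) ⟩
      nodesAt ((nonLeaves F₂ ++ leaves F₂) ++ c e) Q (2 + k)
        ≡⟨ cong (λ z → nodesAt z Q (2 + k)) (LP.++-assoc (nonLeaves F₂) (leaves F₂) (c e)) ⟩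
      nodesAt (nonLeaves F₂ ++ leaves F₂ ++ c e) Q (2 + k)
        ≡⟨ sym (nodesAt-++ (nonLeaves F₂) (leaves F₂ ++ c e) Q (2 + k) nonLeaves-F₂≤Q) ⟩
      Z ++ nodesAt (leaves F₂ ++ c e) _ _            ≡⟨ cong (Z ++_) (nodesAt-leaves (leaves F₂ ++ c e) _ _
                                                                  (AllP.++⁺ (leaves-IsLeaf F₂) (AllP.replicate⁺ e isl))) ⟩
      Z ++ []                                        ≡⟨ LP.++-identityʳ Z ⟩
      Z                                              ∎
      where open ≡-Reasoning

    nodesF-◁ : nodesF (F₁ ◁ F₂) ≡ X ++ Z
    nodesF-◁ = begin
      nodesF (F₁ ◁ F₂)                               ≡⟨ nodesL-run (F₁ ◁ F₂) N refl ⟩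
      runNodes (rootSlots N) 1 (pwL (F₁ ◁ F₂))       ≡⟨ cong (runNodes (rootSlots N) 1) pwL-◁ ⟩
      runNodes (rootSlots N) 1 (flat bs ++ pwL G)    ≡⟨ runNodes-++ (rootSlots N) 1 (flat bs) (pwL G) ⟩
      X ++ runNodes Y _ (pwL G)                      ≡⟨ cong (X ++_) (cong₂ (λ S w → runNodes S c₁ w) Y≡ (sym (LP.++-identityʳ (pwL G)))) ⟩
      X ++ runNodes (Q ++ sentinel ∷ []) _ (pwL G ++ [])
        ≡⟨ cong (X ++_) (runNodes-pwL G Q (sentinel ∷ []) _ [] length-G) ⟩
      X ++ (nodesAt G Q (suc (runCount (rootSlots N) 1 (flat bs))) ++ [])
        ≡⟨ cong (λ z → X ++ z) (trans (LP.++-identityʳ _) (trans (cong (λ m → nodesAt G Q (suc m)) runCount-X) nodesAt-G)) ⟩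
      X ++ Z                                         ∎
      where
      open ≡-Reasoning
      c₁ = runCount (rootSlots N) 1 (flat bs)
      length-G : length G ≡ length Q
      length-G = trans (LP.length-++ F₂) (trans (cong (length F₂ +_) (LP.length-replicate e))
                                                 (trans (NP.+-comm (length F₂) e) (sym length-Q)))

    Y-pa≤ : All (λ q → slotPa q ≤ suc k) Y
    Y-pa≤ = subst (λ m → All (λ q → slotPa q ≤ m) Y) runCount-X (runStack-pa≤ (rootSlots N) 1 (flat bs) (rootSlots-pa≤ N))

    descending-Y : Descending Y
    descending-Y = runStack-descending (rootSlots N) 1 (flat bs) (rootSlots-pa≤ N) (descending-rootSlots N)

    grafted-Z : Grafted k Y (nodesF F₂) Z
    grafted-Z = subst₂ (λ S z → Grafted k S z Z) (sym Y≡) (sym (nodesL-leaning F₂ (length F₂) 1 2 h₂))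
      (grafted-++ʳ k (sentinel ∷ []) (grafted-nodesL k (nonLeaves F₂) Q (length F₂) 1 2 (nonLeaves-IsNode F₂) nonLeaves-F₂≤Q (s≤s (s≤s z≤n))))

    variant-X : Pointwise RootArityVariant (nodesF F₁) X
    variant-X = subst (Pointwise RootArityVariant (nodesF F₁)) (sym X≡) (nodesL-variant F₁ k N 1 2)

    ranked-X : Ranked N 1 X
    ranked-X = subst (Ranked N 1) (sym (trans X≡ (nodesL-leaning F₁ N 1 2 h₁)))
      (subst (λ z → Ranked N 1 (nodesL z 1 N 1 2)) (LP.++-identityʳ (nonLeaves F₁))
             (ranked-nodesL-++ (nonLeaves F₁) [] N 1 2 (nonLeaves-IsNode F₁) [] (s≤s (s≤s z≤n))))

    length-bs : length bs ≡ k
    length-bs = trans (length-blocks F₁ bs e pwL-F₁) (balanced⇒degL≡length F₁ (proj₁ h₁))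

    module _ (F : Forest Σ) (h : Leaning F) where

      ≼◁⇒⇑≼×⇓≼ : F ≼N (F₁ ◁ F₂) → (⇑ k F ≼N F₁) × (⇓ k F ≼N F₂)
      ≼◁⇒⇑≼×⇓≼ (eN , le) = (length-⇑k , upper) , (trans (Lower.length-⇓ k F h) length-∸k , lower)
        where
        length-F : length F ≡ k + length F₂
        length-F = trans eN length-◁
        k≤n : k ≤ length F
        k≤n = subst (k ≤_) (sym length-F) (NP.m≤m+n k (length F₂))
        length-⇑k : length (⇑ k F) ≡ k
        length-⇑k = trans (Upper.length-⇑ k F h) (NP.m≥n⇒m⊓n≡n k≤n)
        length-∸k : length F ∸ k ≡ length F₂
        length-∸k = trans (cong (_∸ k) length-F) (NP.m+n∸m≡n k (length F₂))
        parts = Nodewise-++ʳ⁻ k (nodesF F) X Z length-X (subst (Nodewise CncLe (nodesF F)) nodesF-◁ le)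
        upper : Nodewise CncLe (nodesF (⇑ k F)) (nodesF F₁)
        upper = nodewise-weak⇒cncLe (subst (λ z → Ranked z 1 (nodesF (⇑ k F))) length-⇑k (Upper.ranked-⇑ k F h))
                                    (ranked-leaning F₁ h₁)
          (Nodewise-pull proj₁ proj₁ (weak-resp-variant⁻ {Σ = Σ})
                         (Upper.nodesF-⇑ k F h) variant-X (nodewise-cncLe⇒weak (proj₁ parts)))
        lower : Nodewise CncLe (nodesF (⇓ k F)) (nodesF F₂)
        lower = nodewise-weak⇒cncLe (subst (λ z → Ranked z 1 (nodesF (⇓ k F))) length-∸k (Lower.ranked-⇓ k F h))
                                    (ranked-leaning F₂ h₂)
          (Nodewise-pull proj₁ proj₁ (λ r₁ r₂ → weak-unshift {Σ = Σ} (shifted⇒shifted′ {Σ = Σ} r₁) r₂)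
                         (Lower.nodesF-⇓ k F h) (grafted⇒shifted′ k Y-pa≤ grafted-Z) (nodewise-cncLe⇒weak (proj₂ parts)))

      ⇑≼×⇓≼⇒≼◁ : (⇑ k F ≼N F₁) × (⇓ k F ≼N F₂) → F ≼N (F₁ ◁ F₂)
      ⇑≼×⇓≼⇒≼◁ ((e₁ , le₁) , (e₂ , le₂)) =
        length-eq , subst (Nodewise CncLe (nodesF F)) (sym nodesF-◁) (Nodewise-++ʳ⁺ k (nodesF F) X Z upper lower)
        where
        k≤n : k ≤ length F
        k≤n = subst (_≤ length F) (trans (sym (Upper.length-⇑ k F h)) e₁) (NP.m⊓n≤m (length F) k)
        length-eq : length F ≡ N
        length-eq = trans (sym (NP.m+[n∸m]≡n k≤n)) (trans (cong (k +_) (trans (sym (Lower.length-⇓ k F h)) e₂)) (sym length-◁))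
        module P = PrefixRun F (proj₁ h) N k length-eq k≤n
        upper : Nodewise CncLe (take k (nodesF F)) X
        upper = nodewise-weak⇒cncLe (ranked-take k (subst (λ a → Ranked a 1 (nodesF F)) length-eq (ranked-leaning F h))) ranked-X
          (Nodewise-push proj₁ proj₁ (weak-resp-variant {Σ = Σ}) (Upper.nodesF-⇑ k F h) variant-X (nodewise-cncLe⇒weak le₁))
        stack-⊆ : P.Y ⊆ Y
        stack-⊆ = runStack-⊆ P.prefix bs (rootSlots N) (rootSlots N) 1 ⊆-refl (descending-rootSlots N) (rootSlots-pa≤ N)
          (trans P.length-prefix (sym length-bs)) (subst (λ z → Nodewise CncLe z X) P.take-nodesF upper)
        lower : Nodewise CncLe (drop k (nodesF F)) Z
        lower =
          trans (sym (decs-pointwise proj₁ (Lower.nodesF-⇓ k F h)))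
                (trans (proj₁ le₂) (decs-pointwise proj₁ (grafted⇒shifted′ k Y-pa≤ grafted-Z))) ,
          subst (λ z → Pointwise CncLe z Z) (sym P.drop-nodesF)
            (suffix-cncLe k P.suffix [] P.Y Y (suc k) (nodesF (⇓ k F)) (nodesF F₂) Z [] P.Y-pa≤ NP.≤-refl stack-⊆ descending-Y
               (subst (Pointwise (Shifted k) (nodesF (⇓ k F))) P.drop-nodesF (Lower.nodesF-⇓ k F h)) (proj₂ le₂) grafted-Z)

≼◁⇔ : ∀ {Σ} (F₁ F₂ F : Forest Σ) → Leaning F₁ → Leaning F₂ → Leaning F →
      (F ≼F (F₁ ◁ F₂)) ⇔ ((⇑ (length F₁) F ≼F F₁) × (⇓ (length F₁) F ≼F F₂))
≼◁⇔ F₁ F₂ F h₁ h₂ h = ⇔-trans (≼F⇔≼N F (F₁ ◁ F₂))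
  (⇔-trans (mk⇔ (Under.≼◁⇒⇑≼×⇓≼ F₁ F₂ h₁ h₂ F h) (Under.⇑≼×⇓≼⇒≼◁ F₁ F₂ h₁ h₂ F h))
           (⇔-sym (≼F⇔≼N (⇑ (length F₁) F) F₁) ×-⇔ ⇔-sym (≼F⇔≼N (⇓ (length F₁) F) F₂)))

lemma4p3p5 : {Σ : Signature} (F₁ F₂ F : Forest Σ) →
    Leaning F₁ → Leaning F₂ → Leaning F →
    (((F₁ ▷ F₂) ≼F F) ⇔ ((F₁ ≼F ⇑ (length F₁) F) × (F₂ ≼F ⇓ (length F₁) F)))
    × ((F ≼F (F₁ ◁ F₂)) ⇔ ((⇑ (length F₁) F ≼F F₁) × (⇓ (length F₁) F ≼F F₂)))
lemma4p3p5 F₁ F₂ F h₁ h₂ h = ▷≼⇔ F₁ F₂ F h₁ h₂ h , ≼◁⇔ F₁ F₂ F h₁ h₂ h
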